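{- Let $r$, $k$, $p$, $v$ and $w$ be positive integers with $r \ge k > p$. Let $a, b, m$ be the unique integers with $v = \binom{a}{k}_r + \binom{b}{k-1}_{r-1} + m$, $a - \lfloor a/r\rfloor > b$ and $\binom{b - \lfloor b/(r-1)\rfloor}{k-2}_{r-2} > m \ge 0$. If $$w \ge \binom{a}{p}_r + \binom{b}{p-1}_{r-1} + d_{p,r}^k(m),$$ then the construction described below (with targets $v$ and $w$) does not fail and gives a flag complex $\Delta$ of dimension at most $r-1$ with $f_{k-1}(\Delta) = v$ and $f_{p-1}(\Delta) = w$.
   Context: A flag complex is the clique complex of a graph (faces = vertex sets of cliques); $f_{i-1}(\Delta)$ is the number of faces with $i$ vertices, and the dimension is one less than the maximum face size. The Turán graph $T_{n,r}$ partitions $n$ vertices into $r$ parts as evenly as possible, with two vertices adjacent exactly when in different parts; $\binom{n}{k}_r$ is the number of $k$-vertex cliques of $T_{n,r}$. For $m > 0$, $j_k^r(m)$ is the unique integer with $\binom{j_k^r(m)}{k-1}_{r-1} \le m < \binom{j_k^r(m)+1}{k-1}_{r-1}$, and $d_{p,r}^k(0) = 0$, $d_{p,r}^k(m) = \binom{j_k^r(m)}{p-1}_{r-1} + d_{p,r}^k\!\left(m - \binom{j_k^r(m)}{k-1}_{r-1}\right)$ for $m > 0$. The construction: let $n_0$ be the unique integer with $\binom{n_0}{k}_r \le v < \binom{n_0+1}{k}_r$, $m_0 = v - \binom{n_0}{k}_r$. For $i \ge 1$: if $m_{i-1}=0$ set $z = i-1$ and stop; else let $n_i$ be the unique integer with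 $\binom{n_i}{k-1}_{r-1} \le m_{i-1} < \binom{n_i+1}{k-1}_{r-1}$ and $m_i = m_{i-1} - \binom{n_i}{k-1}_{r-1}$. Take the graph consisting of $T_{n_0,r}$ together with new vertices $v_1,\dots,v_z$, where the neighbourhood of $v_i$ is a vertex set of $T_{n_0,r}$ inducing a copy of $T_{n_i,r-1}$ (and $v_i$ has no other neighbours); let $\Delta$ be its clique complex. If $f_{p-1}(\Delta) > w$ the construction fails; otherwise add $w - f_{p-1}(\Delta)$ new vertices, each adjacent to exactly $p-1$ pairwise adjacent vertices of the original $T_{n_0,r}$, and take the clique complex. -}

module Defs where

open import Data.Bool using (Bool; true; false; not; _∧_; _∨_; if_then_else_)
open import Data.Nat using (ℕ; zero; suc; _+_; _∸_; _≤_; _<_; _≡ᵇ_; _/_; _%_)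
open import Data.Fin using (Fin; toℕ; splitAt; _≟_)
open import Data.Fin.Subset using (Subset; ∣_∣; _∈_)
open import Data.List using (List; []; _∷_; _++_; map; length; filterᵇ; allFin; lookup)
open import Data.List using (foldr)

allᵇ : {A : Set} → (A → Bool) → List A → Bool
allᵇ f = foldr (λ x b → f x ∧ b) true
open import Data.List.Relation.Unary.All using (All)
open import Data.List.Relation.Binary.Pointwise using (Pointwise)
open import Data.Vec using (Vec; []; _∷_)
import Data.Vec as Vec
open import Data.Sum using (inj₁; inj₂)
open import Data.Product using (Σ; ∃; _×_)
open import Function.Bundles using (_⇔_)
open import Function.Definitions using (Injective)
open import Relation.Nullary using (does)
open import Relation.Binary.PropositionalEquality using (_≡_)

record Graph : Set where
  field
    size : ℕ
    adj  : Fin size → Fin size → Bool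
open Graph public

isClique : (G : Graph) → Subset (size G) → Bool
isClique G S =
  allᵇ (λ i → allᵇ (λ j →
        not (Vec.lookup S i ∧ Vec.lookup S j ∧ not (does (i ≟ j))) ∨ adj G i j)
      (allFin (size G)))
    (allFin (size G))

allSubsets : (n : ℕ) → List (Subset n)
allSubsets zero    = [] ∷ []
allSubsets (suc n) = map (true ∷_) (allSubsets n) ++ map (false ∷_) (allSubsets n)

-- faces G i = f_{i-1}(Δ(G)) : number of faces of the clique complex with i vertices
faces : Graph → ℕ → ℕ
faces G i = length (filterᵇ (λ S → (∣ S ∣ ≡ᵇ i) ∧ isClique G S) (allSubsets (size G)))

-- the clique complex has dimension at most r - 1 (every face has ≤ r vertices)
dimAtMost : Graph → ℕ → Set
dimAtMost G r = (S : Subset (size G)) → isClique G S ≡ true → ∣ S ∣ ≤ r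

-- Turán graph T_{n,r}: vertex x lies in part (x mod r); parts are as even
-- as possible.  (r = 0 only ever occurs with n = 0.)

part : ℕ → ℕ → ℕ
part zero    x = zero
part (suc r) x = x % suc r

turanAdj : ∀ {n} → ℕ → Fin n → Fin n → Bool
turanAdj r i j = not (part r (toℕ i) ≡ᵇ part r (toℕ j))

turan : ℕ → ℕ → Graph
turan n r = record { size = n ; adj = turanAdj r }

-- binom n k r = \binom{n}{k}_r = number of k-vertex cliques of T_{n,r}
binomT : ℕ → ℕ → ℕ → ℕ
binomT n k r = faces (turan n r) k

-- floor division (divisor 0 never used)
_div_ : ℕ → ℕ → ℕ
a div zero  = zero
a div suc r = a / suc r

-- d^k_{p,r}(m) as a relation:  DRel p r k m d  means  d = d^k_{p,r}(m),
-- with j = j^r_k(m) characterised by its defining inequalities.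

data DRel (p r k : ℕ) : ℕ → ℕ → Set where
  d-zero : DRel p r k 0 0
  d-step : ∀ {m j d} → 0 < m →
           binomT j (k ∸ 1) (r ∸ 1) ≤ m →
           m < binomT (suc j) (k ∸ 1) (r ∸ 1) →
           DRel p r k (m ∸ binomT j (k ∸ 1) (r ∸ 1)) d →
           DRel p r k m (binomT j (p ∸ 1) (r ∸ 1) + d)

-- The numerical part of the construction: n_0 and the sequence n_1..n_z.

data Tail (k r : ℕ) : ℕ → List ℕ → Set where
  tail-stop : Tail k r 0 []
  tail-step : ∀ {m n ns} → 0 < m →
              binomT n (k ∸ 1) (r ∸ 1) ≤ m →
              m < binomT (suc n) (k ∸ 1) (r ∸ 1) →
              Tail k r (m ∸ binomT n (k ∸ 1) (r ∸ 1)) ns →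
              Tail k r m (n ∷ ns)

Run : (k r v n0 : ℕ) → List ℕ → Set
Run k r v n0 ns = binomT n0 k r ≤ v × v < binomT (suc n0) k r × Tail k r (v ∸ binomT n0 k r) ns

-- T_{n0,r} together with one new vertex for each listed neighbourhood
-- (a subset of the vertices of T_{n0,r}); new vertices are pairwise non-adjacent.
cone : (n0 r : ℕ) → List (Subset n0) → Graph
cone n0 r Ns = record { size = n0 + length Ns ; adj = a }
  where
  a : Fin (n0 + length Ns) → Fin (n0 + length Ns) → Bool
  a i j with splitAt n0 i | splitAt n0 j
  ... | inj₁ x | inj₁ y = turanAdj r x y
  ... | inj₁ x | inj₂ t = Vec.lookup (lookup Ns t) x
  ... | inj₂ t | inj₁ y = Vec.lookup (lookup Ns t) y
  ... | inj₂ _ | inj₂ _ = false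

InducesTuran : (n0 r n s : ℕ) → Subset n0 → Set
InducesTuran n0 r n s N =
  Σ (Fin n → Fin n0) λ e →
    Injective _≡_ _≡_ e ×
    ((x : Fin n0) → (x ∈ N) ⇔ (∃ λ y → e y ≡ x)) ×
    ((y₁ y₂ : Fin n) → turanAdj r (e y₁) (e y₂) ≡ turanAdj s y₁ y₂)

-- neighbourhood of v_i induces a copy of T_{n_i, r-1}
NbhdsOK : (n0 r : ℕ) → List ℕ → List (Subset n0) → Set
NbhdsOK n0 r ns Ns = Pointwise (λ n N → InducesTuran n0 r n (r ∸ 1) N) ns Ns

-- each extra vertex is adjacent to exactly p-1 pairwise adjacent vertices of T_{n0,r}
ExtrasOK : (n0 r p : ℕ) → List (Subset n0) → Set
ExtrasOK n0 r p Es = All (λ S → ∣ S ∣ ≡ p ∸ 1 × isClique (turan n0 r) S ≡ true) Es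

ConstructionSucceeds : (r k p v w : ℕ) → Set
ConstructionSucceeds r k p v w =
  -- (i) no valid run fails: f_{p-1} of the intermediate complex is ≤ w
  ((n0 : ℕ) (ns : List ℕ) (Ns : List (Subset n0)) →
     Run k r v n0 ns → NbhdsOK n0 r ns Ns → faces (cone n0 r Ns) p ≤ w)
  ×
  (Σ ℕ λ n0 → Σ (List ℕ) λ ns → Σ (List (Subset n0)) λ Ns → Σ (List (Subset n0)) λ Es →
     Run k r v n0 ns × NbhdsOK n0 r ns Ns × ExtrasOK n0 r p Es ×
     length Es ≡ w ∸ faces (cone n0 r Ns) p)
  ×
  ((n0 : ℕ) (ns : List ℕ) (Ns Es : List (Subset n0)) →
     Run k r v n0 ns → NbhdsOK n0 r ns Ns → ExtrasOK n0 r p Es →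
     length Es ≡ w ∸ faces (cone n0 r Ns) p →
     dimAtMost (cone n0 r (Ns ++ Es)) r ×
     faces (cone n0 r (Ns ++ Es)) k ≡ v ×
     faces (cone n0 r (Ns ++ Es)) p ≡ w)

module Submission where

-- Faces of a clique complex are counted as sums of 0/1-indicators over all
-- subsets of the vertex set.  Splitting a subset of the cone over T_{n0,r}
-- into its part inside T_{n0,r} and its set of new vertices gives the cone
-- formula: the (j+1)-faces of the cone are the (j+1)-cliques of T_{n0,r}
-- plus, for every new vertex with neighbourhood N, the j-cliques of T_{n0,r}
-- inside N.  If N induces a copy of T_{n,s} this last count is binom(n,j)_s.
-- The same splitting applied to the last vertex of T_{n+1,r} gives a Turán
-- recursion, and embedding T_{n',r-1} (n' ≤ n - ⌊n/r⌋) in the neighbourhood of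
-- that vertex gives the inequality binom(n,j+1)_r + binom(n',j)_{r-1} ≤
-- binom(n+1,j+1)_r, hence monotonicity of binom(-,j)_r.  These identify the
-- run of the construction (n_0 = a, n_1 = b, then the greedy sequence of
-- d^k_{p,r}(m)), compute f_{k-1} and f_{p-1} of every outcome, and provide
-- the neighbourhoods needed to carry the construction out.  Dimension ≤ r-1
-- holds because colour classes (residues mod r) of a Turán graph are
-- independent, so every clique of T_{n0,r} inside a neighbourhood has at
-- most r-1 vertices.

open import Defs
open import Data.Bool using (Bool; true; false; not; _∧_; _∨_; T) renaming (_≟_ to _≟ᵇ_)
open import Data.Bool.Properties using (∧-zeroʳ; T?; T-≡)
open import Data.Nat using (ℕ; zero; suc; _+_; _*_; _∸_; _≤_; _<_; z≤n; s≤s; _≡ᵇ_; _/_; _%_; _<?_; _≤?_; _≟_)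
open import Data.Nat.Properties
open import Algebra.Properties.CommutativeSemigroup +-commutativeSemigroup using () renaming (interchange to +-interchange)
open import Data.Nat.DivMod using (m≡m%n+[m/n]*n; [m+kn]%n≡m%n; m%n<n; m<n⇒m%n≡m; n/1≡n)
open import Data.Nat.ListAction using (sum)
open import Data.Nat.ListAction.Properties using (sum-++)
open import Data.Fin using (Fin; zero; suc; toℕ; fromℕ; fromℕ<; splitAt; _↑ˡ_; _↑ʳ_; inject₁) renaming (_≟_ to _≟ᶠ_)
open import Data.Fin.Properties
  using (any?; toℕ-fromℕ<; toℕ-injective; toℕ<n; toℕ-inject₁; toℕ-fromℕ; fromℕ≢inject₁; inject₁-injective;
         splitAt-↑ˡ; splitAt-↑ʳ; splitAt⁻¹-↑ˡ; splitAt⁻¹-↑ʳ; ↑ˡ-injective)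
open import Data.Fin.Subset using (Subset; ∣_∣; ⁅_⁆) renaming (⊥ to ∅; _∈_ to _∈ˢ_; _⊆_ to _⊆ˢ_)
open import Data.Fin.Subset.Properties using (_⊆?_; ∣⊥∣≡0; ∣⁅x⁆∣≡1; ∣p∣≤n; p⊆q⇒∣p∣≤∣q∣)
open import Data.List using (List; []; _∷_; _++_; map; length; filterᵇ; allFin; replicate)
import Data.List as L
open import Data.List.Properties using (map-++; map-∘; length-++; length-tabulate; length-replicate)
open import Data.List.Membership.Propositional using () renaming (_∈_ to _∈ₗ_)
open import Data.List.Membership.Propositional.Properties
  using (∈-++⁺ˡ; ∈-++⁺ʳ; ∈-map⁺; ∈-map⁻; ∈-∃++; ∈-filter⁺; ∈-filter⁻; ∈-allFin; ∈-lookup)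
open import Data.List.Relation.Unary.Any using (here; there)
open import Data.List.Relation.Unary.All using (All; []; _∷_)
import Data.List.Relation.Unary.All as All
open import Data.List.Relation.Unary.All.Properties using (replicate⁺; ++⁺)
open import Data.List.Relation.Unary.AllPairs using ([]; _∷_)
open import Data.List.Relation.Unary.Unique.Propositional using (Unique)
import Data.List.Relation.Unary.Unique.Propositional.Properties as Unique
open import Data.List.Relation.Binary.Pointwise using ([]; _∷_)
open import Data.Vec using (Vec; []; _∷_; _∷ʳ_; lookup; tabulate) renaming (_++_ to _++ᵛ_)
import Data.Vec as V
open import Data.Vec.Properties
  using (∷-injectiveʳ; lookup-++ˡ; lookup-++ʳ; lookup-replicate; lookup∘tabulate; tabulate∘lookup; tabulate-cong;
         []=⇒lookup; lookup⇒[]=)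
open import Data.Product using (Σ; ∃; _×_; _,_; proj₁; proj₂)
open import Data.Sum using (_⊎_; inj₁; inj₂; map₂)
open import Data.Empty using (⊥; ⊥-elim)
open import Relation.Nullary using (Dec; yes; no; does)
open import Relation.Nullary.Decidable using (_×-dec_)
open import Relation.Binary.PropositionalEquality
open import Function using (_∘_; id)
open import Function.Bundles using (_⇔_; mk⇔; Equivalence)

indicator : Bool → ℕ
indicator true  = 1
indicator false = 0

true≢false : true ≢ false
true≢false ()

bool-ext : {b c : Bool} → (b ≡ true → c ≡ true) → (c ≡ true → b ≡ true) → b ≡ c
bool-ext {true}  {true}  f g = refl
bool-ext {true}  {false} f g = sym (f refl)
bool-ext {false} {true}  f g = g refl
bool-ext {false} {false} f g = refl

∧-elimˡ : {a b : Bool} → a ∧ b ≡ true → a ≡ true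
∧-elimˡ {true} _ = refl

∧-elimʳ : {a b : Bool} → a ∧ b ≡ true → b ≡ true
∧-elimʳ {true} e = e

∧-intro : {a b : Bool} → a ≡ true → b ≡ true → a ∧ b ≡ true
∧-intro refl refl = refl

T⇒≡true : {b : Bool} → T b → b ≡ true
T⇒≡true = Equivalence.to T-≡

≡true⇒T : {b : Bool} → b ≡ true → T b
≡true⇒T = Equivalence.from T-≡

≡ᵇ-sound : {a b : ℕ} → (a ≡ᵇ b) ≡ true → a ≡ b
≡ᵇ-sound {a} {b} e = ≡ᵇ⇒≡ a b (≡true⇒T e)

≡ᵇ-complete : {a b : ℕ} → a ≡ b → (a ≡ᵇ b) ≡ true
≡ᵇ-complete {a} {b} e = T⇒≡true (≡⇒≡ᵇ a b e)

≡ᵇ-false : {a b : ℕ} → a ≢ b → (a ≡ᵇ b) ≡ false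
≡ᵇ-false {a} {b} ne with a ≡ᵇ b in e
... | false = refl
... | true  = ⊥-elim (ne (≡ᵇ-sound e))

≡ᵇ-sym : (a b : ℕ) → (a ≡ᵇ b) ≡ (b ≡ᵇ a)
≡ᵇ-sym a b = bool-ext (λ e → ≡ᵇ-complete (sym (≡ᵇ-sound {a} {b} e)))
                      (λ e → ≡ᵇ-complete (sym (≡ᵇ-sound {b} {a} e)))

sumSub : (n : ℕ) → (Subset n → ℕ) → ℕ
sumSub zero    f = f []
sumSub (suc n) f = sumSub n (λ S → f (true ∷ S)) + sumSub n (λ S → f (false ∷ S))

length-filterᵇ : {A : Set} (P : A → Bool) (xs : List A) →
  length (filterᵇ P xs) ≡ sum (map (indicator ∘ P) xs)
length-filterᵇ P [] = refl
length-filterᵇ P (x ∷ xs) with P x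
... | true  = cong suc (length-filterᵇ P xs)
... | false = length-filterᵇ P xs

sum-allSubsets : (n : ℕ) (f : Subset n → ℕ) → sum (map f (allSubsets n)) ≡ sumSub n f
sum-allSubsets zero f = +-identityʳ (f [])
sum-allSubsets (suc n) f = begin
  sum (map f (map (true ∷_) Ss ++ map (false ∷_) Ss))
    ≡⟨ cong sum (map-++ f (map (true ∷_) Ss) (map (false ∷_) Ss)) ⟩
  sum (map f (map (true ∷_) Ss) ++ map f (map (false ∷_) Ss))
    ≡⟨ sum-++ (map f (map (true ∷_) Ss)) (map f (map (false ∷_) Ss)) ⟩
  sum (map f (map (true ∷_) Ss)) + sum (map f (map (false ∷_) Ss))
    ≡⟨ cong₂ _+_ (cong sum (sym (map-∘ Ss))) (cong sum (sym (map-∘ Ss))) ⟩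
  sum (map (f ∘ (true ∷_)) Ss) + sum (map (f ∘ (false ∷_)) Ss)
    ≡⟨ cong₂ _+_ (sum-allSubsets n _) (sum-allSubsets n _) ⟩
  sumSub (suc n) f ∎
  where
  open ≡-Reasoning
  Ss = allSubsets n

count≡sumSub : (n : ℕ) (P : Subset n → Bool) →
  length (filterᵇ P (allSubsets n)) ≡ sumSub n (indicator ∘ P)
count≡sumSub n P = trans (length-filterᵇ P (allSubsets n)) (sum-allSubsets n _)

allSubsets-complete : (n : ℕ) (S : Subset n) → S ∈ₗ allSubsets n
allSubsets-complete zero [] = here refl
allSubsets-complete (suc n) (true ∷ S) = ∈-++⁺ˡ (∈-map⁺ (true ∷_) (allSubsets-complete n S))
allSubsets-complete (suc n) (false ∷ S) =
  ∈-++⁺ʳ (map (true ∷_) (allSubsets n)) (∈-map⁺ (false ∷_) (allSubsets-complete n S))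

allSubsets-unique : (n : ℕ) → Unique (allSubsets n)
allSubsets-unique zero = All.[] ∷ []
allSubsets-unique (suc n) =
  Unique.++⁺ (Unique.map⁺ ∷-injectiveʳ (allSubsets-unique n)) (Unique.map⁺ ∷-injectiveʳ (allSubsets-unique n)) disjoint
  where
  disjoint : ∀ {S} → S ∈ₗ map (true ∷_) (allSubsets n) × S ∈ₗ map (false ∷_) (allSubsets n) → ⊥
  disjoint (p , q) with ∈-map⁻ (true ∷_) p | ∈-map⁻ (false ∷_) q
  ... | _ , _ , refl | _ , _ , ()

private
  ∈-remove : {A : Set} {y y' : A} (as bs : List A) → y' ∈ₗ as ++ (y ∷ bs) → y' ≢ y → y' ∈ₗ as ++ bs
  ∈-remove []       bs (here refl) ne = ⊥-elim (ne refl)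
  ∈-remove []       bs (there p)   ne = p
  ∈-remove (a ∷ as) bs (here refl) ne = here refl
  ∈-remove (a ∷ as) bs (there p)   ne = there (∈-remove as bs p ne)

length-≤-by-relation : {A B : Set} (R : A → B → Set) (xs : List A) (ys : List B) → Unique xs →
  (∀ {x x' y} → x ∈ₗ xs → x' ∈ₗ xs → R x y → R x' y → x ≡ x') →
  (∀ {x} → x ∈ₗ xs → ∃ λ y → y ∈ₗ ys × R x y) →
  length xs ≤ length ys
length-≤-by-relation R [] ys u inj total = z≤n
length-≤-by-relation R (x ∷ xs) ys (x∉xs ∷ u) inj total with total (here refl)
... | y , y∈ys , xRy with ∈-∃++ y∈ys
... | as , bs , refl = begin
  suc (length xs)           ≤⟨ s≤s (length-≤-by-relation R xs (as ++ bs) u (λ p q → inj (there p) (there q)) total') ⟩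
  suc (length (as ++ bs))   ≡⟨ cong suc (length-++ as) ⟩
  suc (length as + length bs) ≡⟨ sym (+-suc (length as) (length bs)) ⟩
  length as + length (y ∷ bs) ≡⟨ sym (length-++ as) ⟩
  length (as ++ y ∷ bs)     ∎
  where
  open ≤-Reasoning
  -- y is used up by x, so the other elements of xs are related to elements of as ++ bs
  total' : ∀ {x'} → x' ∈ₗ xs → ∃ λ y' → y' ∈ₗ as ++ bs × R x' y'
  total' {x'} x'∈xs with total (there x'∈xs)
  ... | y' , y'∈ , x'Ry' = y' , ∈-remove as bs y'∈ y'≢y , x'Ry'
    where
    y'≢y : y' ≢ y
    y'≢y refl = All.lookup x∉xs x'∈xs (inj (here refl) (there x'∈xs) xRy x'Ry')

length-≡-by-relation : {A B : Set} (R : A → B → Set) (xs : List A) (ys : List B) → Unique xs → Unique ys →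
  (∀ {x x' y} → x ∈ₗ xs → x' ∈ₗ xs → y ∈ₗ ys → R x y → R x' y → x ≡ x') →
  (∀ {x y y'} → x ∈ₗ xs → y ∈ₗ ys → y' ∈ₗ ys → R x y → R x y' → y ≡ y') →
  (∀ {x} → x ∈ₗ xs → ∃ λ y → y ∈ₗ ys × R x y) →
  (∀ {y} → y ∈ₗ ys → ∃ λ x → x ∈ₗ xs × R x y) →
  length xs ≡ length ys
length-≡-by-relation R xs ys uxs uys inj₁' inj₂' total₁ total₂ = ≤-antisym
  (length-≤-by-relation (λ x y → y ∈ₗ ys × R x y) xs ys uxs
     (λ p q (y∈ , r) (_ , r') → inj₁' p q y∈ r r')
     (λ p → let (y , y∈ , r) = total₁ p in y , y∈ , y∈ , r))
  (length-≤-by-relation (λ y x → x ∈ₗ xs × R x y) ys xs uys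
     (λ p q (x∈ , r) (_ , r') → inj₂' x∈ p q r r')
     (λ p → let (x , x∈ , r) = total₂ p in x , x∈ , x∈ , r))

count-≡-by-relation : {A B : Set} (R : A → B → Set) (xs : List A) (ys : List B) → Unique xs → Unique ys →
  (P : A → Bool) (Q : B → Bool) →
  (∀ {x x' y} → P x ≡ true → P x' ≡ true → Q y ≡ true → R x y → R x' y → x ≡ x') →
  (∀ {x y y'} → P x ≡ true → Q y ≡ true → Q y' ≡ true → R x y → R x y' → y ≡ y') →
  (∀ {x} → x ∈ₗ xs → P x ≡ true → ∃ λ y → y ∈ₗ ys × Q y ≡ true × R x y) →
  (∀ {y} → y ∈ₗ ys → Q y ≡ true → ∃ λ x → x ∈ₗ xs × P x ≡ true × R x y) →
  length (filterᵇ P xs) ≡ length (filterᵇ Q ys)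
count-≡-by-relation R xs ys uxs uys P Q inj₁' inj₂' total₁ total₂ =
  length-≡-by-relation R (filterᵇ P xs) (filterᵇ Q ys)
    (Unique.filter⁺ (T? ∘ P) {xs = xs} uxs) (Unique.filter⁺ (T? ∘ Q) {xs = ys} uys)
    (λ p q r → inj₁' (holdsP p) (holdsP q) (holdsQ r)) (λ p q r → inj₂' (holdsP p) (holdsQ q) (holdsQ r))
    (λ p → let (y , y∈ , qy , r) = total₁ (inP p) (holdsP p)
           in y , ∈-filter⁺ (T? ∘ Q) y∈ (≡true⇒T qy) , r)
    (λ q → let (x , x∈ , px , r) = total₂ (inQ q) (holdsQ q)
           in x , ∈-filter⁺ (T? ∘ P) x∈ (≡true⇒T px) , r)
  where
  inP : ∀ {x} → x ∈ₗ filterᵇ P xs → x ∈ₗ xs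
  inP p = proj₁ (∈-filter⁻ (T? ∘ P) {xs = xs} p)
  holdsP : ∀ {x} → x ∈ₗ filterᵇ P xs → P x ≡ true
  holdsP p = T⇒≡true (proj₂ (∈-filter⁻ (T? ∘ P) {xs = xs} p))
  inQ : ∀ {y} → y ∈ₗ filterᵇ Q ys → y ∈ₗ ys
  inQ q = proj₁ (∈-filter⁻ (T? ∘ Q) {xs = ys} q)
  holdsQ : ∀ {y} → y ∈ₗ filterᵇ Q ys → Q y ≡ true
  holdsQ q = T⇒≡true (proj₂ (∈-filter⁻ (T? ∘ Q) {xs = ys} q))

sumSub-cong : (n : ℕ) {f g : Subset n → ℕ} → (∀ S → f S ≡ g S) → sumSub n f ≡ sumSub n g
sumSub-cong zero    e = e []
sumSub-cong (suc n) e = cong₂ _+_ (sumSub-cong n (e ∘ (true ∷_))) (sumSub-cong n (e ∘ (false ∷_)))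

sumSub-mono : (n : ℕ) {f g : Subset n → ℕ} → (∀ S → f S ≤ g S) → sumSub n f ≤ sumSub n g
sumSub-mono zero    e = e []
sumSub-mono (suc n) e = +-mono-≤ (sumSub-mono n (e ∘ (true ∷_))) (sumSub-mono n (e ∘ (false ∷_)))

sumSub-zero : (n : ℕ) {f : Subset n → ℕ} → (∀ S → f S ≡ 0) → sumSub n f ≡ 0
sumSub-zero zero    e = e []
sumSub-zero (suc n) e = cong₂ _+_ (sumSub-zero n (e ∘ (true ∷_))) (sumSub-zero n (e ∘ (false ∷_)))

sumSub-+ : (n : ℕ) (f g : Subset n → ℕ) → sumSub n (λ S → f S + g S) ≡ sumSub n f + sumSub n g
sumSub-+ zero    f g = refl
sumSub-+ (suc n) f g = trans (cong₂ _+_ (sumSub-+ n _ _) (sumSub-+ n _ _))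
  (+-interchange (sumSub n (f ∘ (true ∷_))) (sumSub n (g ∘ (true ∷_))) (sumSub n (f ∘ (false ∷_))) (sumSub n (g ∘ (false ∷_))))

sumSub-++ : (a b : ℕ) (f : Subset (a + b) → ℕ) → sumSub (a + b) f ≡ sumSub a (λ X → sumSub b (λ Y → f (X ++ᵛ Y)))
sumSub-++ zero    b f = refl
sumSub-++ (suc a) b f = cong₂ _+_ (sumSub-++ a b _) (sumSub-++ a b _)

sumSub-∷ʳ : (n : ℕ) (f : Subset (suc n) → ℕ) →
  sumSub (suc n) f ≡ sumSub n (λ X → f (X ∷ʳ true)) + sumSub n (λ X → f (X ∷ʳ false))
sumSub-∷ʳ zero    f = refl
sumSub-∷ʳ (suc n) f =
  trans (cong₂ _+_ (sumSub-∷ʳ n (f ∘ (true ∷_))) (sumSub-∷ʳ n (f ∘ (false ∷_))))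
    (+-interchange (sumSub n (λ X → f (true ∷ (X ∷ʳ true)))) (sumSub n (λ X → f (true ∷ (X ∷ʳ false))))
                   (sumSub n (λ X → f (false ∷ (X ∷ʳ true)))) (sumSub n (λ X → f (false ∷ (X ∷ʳ false)))))

sumSub-point : (n : ℕ) (E : Subset n) (f : Subset n → ℕ) → (∀ X → X ≢ E → f X ≡ 0) → sumSub n f ≡ f E
sumSub-point zero [] f h = refl
sumSub-point (suc n) (true ∷ E) f h =
  trans (cong₂ _+_ (sumSub-point n E _ (λ X ne → h _ (ne ∘ ∷-injectiveʳ))) (sumSub-zero n (λ X → h _ (λ ()))))
        (+-identityʳ _)
sumSub-point (suc n) (false ∷ E) f h =
  cong₂ _+_ (sumSub-zero n (λ X → h _ (λ ()))) (sumSub-point n E _ (λ X ne → h _ (ne ∘ ∷-injectiveʳ)))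

sumFin : (n : ℕ) → (Fin n → ℕ) → ℕ
sumFin zero    f = 0
sumFin (suc n) f = f zero + sumFin n (f ∘ suc)

sumFin-cong : (n : ℕ) {f g : Fin n → ℕ} → (∀ t → f t ≡ g t) → sumFin n f ≡ sumFin n g
sumFin-cong zero    e = refl
sumFin-cong (suc n) e = cong₂ _+_ (e zero) (sumFin-cong n (e ∘ suc))

sumSub-sumFin : (n L : ℕ) (f : Subset n → Fin L → ℕ) →
  sumSub n (λ X → sumFin L (f X)) ≡ sumFin L (λ t → sumSub n (λ X → f X t))
sumSub-sumFin n zero    f = sumSub-zero n (λ _ → refl)
sumSub-sumFin n (suc L) f = trans (sumSub-+ n _ _) (cong (sumSub n (λ X → f X zero) +_) (sumSub-sumFin n L _))

sumFin-lookup : {A : Set} (g : A → ℕ) (xs : List A) → sumFin (length xs) (g ∘ L.lookup xs) ≡ sum (map g xs)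
sumFin-lookup g []       = refl
sumFin-lookup g (x ∷ xs) = cong (g x +_) (sumFin-lookup g xs)

allᵇ-elim : {A : Set} (f : A → Bool) (xs : List A) → allᵇ f xs ≡ true → ∀ {x} → x ∈ₗ xs → f x ≡ true
allᵇ-elim f (y ∷ xs) e (here refl) = ∧-elimˡ e
allᵇ-elim f (y ∷ xs) e (there p)   = allᵇ-elim f xs (∧-elimʳ {f y} e) p

allᵇ-intro : {A : Set} (f : A → Bool) (xs : List A) → (∀ {x} → x ∈ₗ xs → f x ≡ true) → allᵇ f xs ≡ true
allᵇ-intro f []       h = refl
allᵇ-intro f (y ∷ xs) h = ∧-intro (h (here refl)) (allᵇ-intro f xs (h ∘ there))

IsClique : (G : Graph) → Subset (size G) → Set
IsClique G S = ∀ i j → lookup S i ≡ true → lookup S j ≡ true → i ≢ j → adj G i j ≡ true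

private
  pair-elim : ∀ {n} (S : Subset n) (a : Bool) (i j : Fin n) →
    (not (lookup S i ∧ lookup S j ∧ not (does (i ≟ᶠ j))) ∨ a) ≡ true →
    lookup S i ≡ true → lookup S j ≡ true → i ≢ j → a ≡ true
  pair-elim S a i j e si sj ne with i ≟ᶠ j
  ... | yes eq = ⊥-elim (ne eq)
  ... | no _ rewrite si | sj = e

  pair-intro : ∀ {n} (S : Subset n) (a : Bool) (i j : Fin n) →
    (lookup S i ≡ true → lookup S j ≡ true → i ≢ j → a ≡ true) →
    (not (lookup S i ∧ lookup S j ∧ not (does (i ≟ᶠ j))) ∨ a) ≡ true
  pair-intro S a i j h with lookup S i | lookup S j | i ≟ᶠ j
  ... | false | _     | _     = refl
  ... | true  | false | _     = refl
  ... | true  | true  | yes _ = refl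
  ... | true  | true  | no ne = h refl refl ne

isClique-sound : (G : Graph) (S : Subset (size G)) → isClique G S ≡ true → IsClique G S
isClique-sound G S e i j si sj ne =
  pair-elim S (adj G i j) i j
    (allᵇ-elim _ (allFin (size G)) (allᵇ-elim _ (allFin (size G)) e (∈-allFin i)) (∈-allFin j)) si sj ne

isClique-complete : (G : Graph) (S : Subset (size G)) → IsClique G S → isClique G S ≡ true
isClique-complete G S c =
  allᵇ-intro _ (allFin (size G)) (λ {i} _ → allᵇ-intro _ (allFin (size G)) (λ {j} _ →
    pair-intro S (adj G i j) i j (c i j)))

_⊑_ : ∀ {n} → Subset n → Subset n → Set
_⊑_ {n} X N = (x : Fin n) → lookup X x ≡ true → lookup N x ≡ true

_⊑ᵇ_ : ∀ {n} → Subset n → Subset n → Bool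
X ⊑ᵇ N = does (X ⊆? N)

⊑ᵇ-sound : ∀ {n} (X N : Subset n) → (X ⊑ᵇ N) ≡ true → X ⊑ N
⊑ᵇ-sound X N e x xi with X ⊆? N
... | yes p = []=⇒lookup (p (lookup⇒[]= x X xi))

⊑ᵇ-complete : ∀ {n} (X N : Subset n) → X ⊑ N → (X ⊑ᵇ N) ≡ true
⊑ᵇ-complete X N h with X ⊆? N
... | yes _  = refl
... | no np = ⊥-elim (np (λ {x} p → lookup⇒[]= x N (h x ([]=⇒lookup p))))

⊑⇒⊆ : ∀ {n} {X N : Subset n} → X ⊑ N → X ⊆ˢ N
⊑⇒⊆ {N = N} s {x} p = lookup⇒[]= x N (s x ([]=⇒lookup p))

module InducedCopy (G : Graph) {n : ℕ} (r : ℕ) (inL : Fin n → Fin (size G))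
  (inL-injective : ∀ {x y} → inL x ≡ inL y → x ≡ y)
  (adj-inL : ∀ x y → adj G (inL x) (inL y) ≡ turanAdj r x y)
  (S : Subset (size G)) (X : Subset n) (trace : ∀ x → lookup S (inL x) ≡ lookup X x) where

  private
    restrict : isClique G S ≡ true → isClique (turan n r) X ≡ true
    restrict e = isClique-complete (turan n r) X (λ x y xi yi ne →
      trans (sym (adj-inL x y)) (isClique-sound G S e (inL x) (inL y)
        (trans (trace x) xi) (trans (trace y) yi) (ne ∘ inL-injective)))

    adj-copy : ∀ x y → lookup S (inL x) ≡ true → lookup S (inL y) ≡ true → inL x ≢ inL y →
               IsClique (turan n r) X → adj G (inL x) (inL y) ≡ true
    adj-copy x y sx sy ne c =
      trans (adj-inL x y) (c x y (trans (sym (trace x)) sx) (trans (sym (trace y)) sy) (λ { refl → ne refl }))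

  clique-inside : (∀ w → (∃ λ x → w ≡ inL x) ⊎ lookup S w ≡ false) → isClique G S ≡ isClique (turan n r) X
  clique-inside cover = bool-ext restrict
    (λ e → isClique-complete G S (λ i j si sj ne → adj-S i j si sj ne (cover i) (cover j) (isClique-sound (turan n r) X e)))
    where
    adj-S : ∀ i j → lookup S i ≡ true → lookup S j ≡ true → i ≢ j →
            (∃ λ x → i ≡ inL x) ⊎ lookup S i ≡ false → (∃ λ x → j ≡ inL x) ⊎ lookup S j ≡ false →
            IsClique (turan n r) X → adj G i j ≡ true
    adj-S i j si sj ne (inj₂ f) _ c = ⊥-elim (true≢false (trans (sym si) f))
    adj-S i j si sj ne (inj₁ _) (inj₂ f) c = ⊥-elim (true≢false (trans (sym sj) f))
    adj-S .(inL x) .(inL y) si sj ne (inj₁ (x , refl)) (inj₁ (y , refl)) c = adj-copy x y si sj ne c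

  clique-apex : (v : Fin (size G)) → lookup S v ≡ true → (∀ x → inL x ≢ v) →
    (N : Subset n) → (∀ x → adj G (inL x) v ≡ lookup N x) → (∀ x → adj G v (inL x) ≡ lookup N x) →
    (∀ w → (∃ λ x → w ≡ inL x) ⊎ w ≡ v ⊎ lookup S w ≡ false) →
    isClique G S ≡ isClique (turan n r) X ∧ (X ⊑ᵇ N)
  clique-apex v sv inL≢v N adj-to-v adj-from-v cover = bool-ext
    (λ e → ∧-intro (restrict e)
             (⊑ᵇ-complete X N (λ x xi → trans (sym (adj-to-v x))
                (isClique-sound G S e (inL x) v (trans (trace x) xi) sv (inL≢v x)))))
    (λ e → isClique-complete G S (λ i j si sj ne →
       adj-S i j si sj ne (cover i) (cover j) (isClique-sound (turan n r) X (∧-elimˡ e))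
         (⊑ᵇ-sound X N (∧-elimʳ {isClique (turan n r) X} e))))
    where
    adj-S : ∀ i j → lookup S i ≡ true → lookup S j ≡ true → i ≢ j →
            (∃ λ x → i ≡ inL x) ⊎ i ≡ v ⊎ lookup S i ≡ false →
            (∃ λ x → j ≡ inL x) ⊎ j ≡ v ⊎ lookup S j ≡ false →
            IsClique (turan n r) X → X ⊑ N → adj G i j ≡ true
    adj-S i j si sj ne (inj₂ (inj₂ f)) _ c s = ⊥-elim (true≢false (trans (sym si) f))
    adj-S i j si sj ne _ (inj₂ (inj₂ f)) c s = ⊥-elim (true≢false (trans (sym sj) f))
    adj-S .(inL x) .(inL y) si sj ne (inj₁ (x , refl)) (inj₁ (y , refl)) c s = adj-copy x y si sj ne c
    adj-S .(inL x) .v si sj ne (inj₁ (x , refl)) (inj₂ (inj₁ refl)) c s =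
      trans (adj-to-v x) (s x (trans (sym (trace x)) si))
    adj-S .v .(inL y) si sj ne (inj₂ (inj₁ refl)) (inj₁ (y , refl)) c s =
      trans (adj-from-v y) (s y (trans (sym (trace y)) sj))
    adj-S .v .v si sj ne (inj₂ (inj₁ refl)) (inj₂ (inj₁ refl)) c s = ⊥-elim (ne refl)

∣++∣ : ∀ {m n} (X : Subset m) (Y : Subset n) → ∣ X ++ᵛ Y ∣ ≡ ∣ X ∣ + ∣ Y ∣
∣++∣ []          Y = refl
∣++∣ (true ∷ X)  Y = cong suc (∣++∣ X Y)
∣++∣ (false ∷ X) Y = ∣++∣ X Y

∣∷ʳ∣ : ∀ {n} (X : Subset n) (b : Bool) → ∣ X ∷ʳ b ∣ ≡ ∣ X ∣ + indicator b
∣∷ʳ∣ []          true  = refl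
∣∷ʳ∣ []          false = refl
∣∷ʳ∣ (true ∷ X)  b     = cong suc (∣∷ʳ∣ X b)
∣∷ʳ∣ (false ∷ X) b     = ∣∷ʳ∣ X b

lookup-∅ : ∀ {n} (u : Fin n) → lookup (∅ {n}) u ≡ false
lookup-∅ u = lookup-replicate u false

lookup-⁅⁆-self : ∀ {n} (t : Fin n) → lookup ⁅ t ⁆ t ≡ true
lookup-⁅⁆-self zero    = refl
lookup-⁅⁆-self (suc t) = lookup-⁅⁆-self t

lookup-⁅⁆-other : ∀ {n} (t u : Fin n) → u ≢ t → lookup ⁅ t ⁆ u ≡ false
lookup-⁅⁆-other zero    zero    ne = ⊥-elim (ne refl)
lookup-⁅⁆-other zero    (suc u) ne = lookup-∅ u
lookup-⁅⁆-other (suc t) zero    ne = refl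
lookup-⁅⁆-other (suc t) (suc u) ne = lookup-⁅⁆-other t u (ne ∘ cong suc)

Fin-suc-injective : ∀ {n} {a b : Fin n} → Fin.suc a ≡ suc b → a ≡ b
Fin-suc-injective refl = refl

data SizeCases {L : ℕ} (Y : Subset L) : Set where
  empty     : Y ≡ ∅ → SizeCases Y
  singleton : (t : Fin L) → Y ≡ ⁅ t ⁆ → SizeCases Y
  two       : (i j : Fin L) → lookup Y i ≡ true → lookup Y j ≡ true → i ≢ j → SizeCases Y

sizeCases : ∀ {L} (Y : Subset L) → SizeCases Y
sizeCases [] = empty refl
sizeCases (false ∷ Y) with sizeCases Y
... | empty refl         = empty refl
... | singleton t refl   = singleton (suc t) refl
... | two i j yi yj ne   = two (suc i) (suc j) yi yj (ne ∘ Fin-suc-injective)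
sizeCases (true ∷ Y) with sizeCases Y
... | empty refl         = singleton zero refl
... | singleton t refl   = two zero (suc t) refl (lookup-⁅⁆-self t) (λ ())
... | two i j yi yj ne   = two zero (suc i) refl yi (λ ())

sumSub-atMostOne : (L : ℕ) (h : Subset L → ℕ) →
  (∀ Y i j → lookup Y i ≡ true → lookup Y j ≡ true → i ≢ j → h Y ≡ 0) →
  sumSub L h ≡ h ∅ + sumFin L (λ t → h ⁅ t ⁆)
sumSub-atMostOne zero h vanish = sym (+-identityʳ _)
sumSub-atMostOne (suc L) h vanish = begin
  sumSub L (h ∘ (true ∷_)) + sumSub L (h ∘ (false ∷_))
    ≡⟨ cong₂ _+_ (sumSub-point L ∅ (h ∘ (true ∷_)) with-zero)
                 (sumSub-atMostOne L (h ∘ (false ∷_)) (λ Y i j yi yj ne → vanish (false ∷ Y) (suc i) (suc j) yi yj (ne ∘ Fin-suc-injective))) ⟩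
  h (true ∷ ∅) + (h (false ∷ ∅) + sumFin L (λ t → h (false ∷ ⁅ t ⁆)))
    ≡⟨ sym (+-assoc (h (true ∷ ∅)) _ _) ⟩
  (h (true ∷ ∅) + h (false ∷ ∅)) + sumFin L (λ t → h (false ∷ ⁅ t ⁆))
    ≡⟨ cong (_+ sumFin L (λ t → h (false ∷ ⁅ t ⁆))) (+-comm (h (true ∷ ∅)) _) ⟩
  (h (false ∷ ∅) + h (true ∷ ∅)) + sumFin L (λ t → h (false ∷ ⁅ t ⁆))
    ≡⟨ +-assoc (h (false ∷ ∅)) _ _ ⟩
  h (false ∷ ∅) + (h (true ∷ ∅) + sumFin L (λ t → h (false ∷ ⁅ t ⁆))) ∎
  where
  open ≡-Reasoning
  with-zero : ∀ X → X ≢ ∅ → h (true ∷ X) ≡ 0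
  with-zero X ne with sizeCases X
  ... | empty e          = ⊥-elim (ne e)
  ... | singleton t refl = vanish (true ∷ ⁅ t ⁆) zero (suc t) refl (lookup-⁅⁆-self t) (λ ())
  ... | two i _ xi _ _   = vanish (true ∷ X) zero (suc i) refl xi (λ ())

cliquesIn : (n r : ℕ) → Subset n → ℕ → ℕ
cliquesIn n r N j = sumSub n (λ X → indicator ((∣ X ∣ ≡ᵇ j) ∧ isClique (turan n r) X ∧ (X ⊑ᵇ N)))

binomT-sumSub : ∀ n q r → binomT n q r ≡ sumSub n (λ S → indicator ((∣ S ∣ ≡ᵇ q) ∧ isClique (turan n r) S))
binomT-sumSub n q r = count≡sumSub n _

-- Vertices of cone n0 r Ls are the vertices of T_{n0,r}
-- (inL) followed by one apex per listed neighbourhood (inR); apexes are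
-- pairwise non-adjacent, so a clique contains at most one of them.

module Cone (n0 r : ℕ) (Ls : List (Subset n0)) where

  private
    L′ : ℕ
    L′ = length Ls
    G : Graph
    G = cone n0 r Ls

    coneAdj : Fin n0 ⊎ Fin L′ → Fin n0 ⊎ Fin L′ → Bool
    coneAdj (inj₁ x) (inj₁ y) = turanAdj r x y
    coneAdj (inj₁ x) (inj₂ t) = lookup (L.lookup Ls t) x
    coneAdj (inj₂ t) (inj₁ y) = lookup (L.lookup Ls t) y
    coneAdj (inj₂ _) (inj₂ _) = false

    adj-split : ∀ i j → adj G i j ≡ coneAdj (splitAt n0 i) (splitAt n0 j)
    adj-split i j with splitAt n0 i | splitAt n0 j
    ... | inj₁ x | inj₁ y = refl
    ... | inj₁ x | inj₂ t = refl
    ... | inj₂ t | inj₁ y = refl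
    ... | inj₂ _ | inj₂ _ = refl

  inL : Fin n0 → Fin (n0 + L′)
  inL x = x ↑ˡ L′

  inR : Fin L′ → Fin (n0 + L′)
  inR t = n0 ↑ʳ t

  private
    adjLL : ∀ x y → adj G (inL x) (inL y) ≡ turanAdj r x y
    adjLL x y rewrite adj-split (inL x) (inL y) | splitAt-↑ˡ n0 x L′ | splitAt-↑ˡ n0 y L′ = refl
    adjLR : ∀ x t → adj G (inL x) (inR t) ≡ lookup (L.lookup Ls t) x
    adjLR x t rewrite adj-split (inL x) (inR t) | splitAt-↑ˡ n0 x L′ | splitAt-↑ʳ n0 L′ t = refl
    adjRL : ∀ x t → adj G (inR t) (inL x) ≡ lookup (L.lookup Ls t) x
    adjRL x t rewrite adj-split (inR t) (inL x) | splitAt-↑ˡ n0 x L′ | splitAt-↑ʳ n0 L′ t = refl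
    adjRR : ∀ t u → adj G (inR t) (inR u) ≡ false
    adjRR t u rewrite adj-split (inR t) (inR u) | splitAt-↑ʳ n0 L′ t | splitAt-↑ʳ n0 L′ u = refl

    inL-injective : ∀ {x y} → inL x ≡ inL y → x ≡ y
    inL-injective {x} {y} = ↑ˡ-injective L′ x y

    split-inR : ∀ t → splitAt n0 (inR t) ≡ inj₂ t
    split-inR t = splitAt-↑ʳ n0 L′ t

    inR-injective : ∀ {t u} → inR t ≡ inR u → t ≡ u
    inR-injective {t} {u} e with trans (sym (split-inR t)) (trans (cong (splitAt n0) e) (split-inR u))
    ... | refl = refl

    inL≢inR : ∀ x t → inL x ≢ inR t
    inL≢inR x t e with trans (sym (splitAt-↑ˡ n0 x L′)) (trans (cong (splitAt n0) e) (split-inR t))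
    ... | ()

    vertex : ∀ w → (∃ λ x → w ≡ inL x) ⊎ (∃ λ t → w ≡ inR t)
    vertex w with splitAt n0 w in eq
    ... | inj₁ x = inj₁ (x , sym (splitAt⁻¹-↑ˡ eq))
    ... | inj₂ t = inj₂ (t , sym (splitAt⁻¹-↑ʳ eq))

  clique-noApex : (X : Subset n0) → isClique G (X ++ᵛ ∅) ≡ isClique (turan n0 r) X
  clique-noApex X = InducedCopy.clique-inside G r inL inL-injective adjLL (X ++ᵛ ∅) X (lookup-++ˡ X ∅) cover
    where
    cover : ∀ w → (∃ λ x → w ≡ inL x) ⊎ lookup (X ++ᵛ ∅) w ≡ false
    cover w with vertex w
    ... | inj₁ p          = inj₁ p
    ... | inj₂ (t , refl) = inj₂ (trans (lookup-++ʳ X ∅ t) (lookup-∅ t))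

  clique-oneApex : (X : Subset n0) (t : Fin L′) →
    isClique G (X ++ᵛ ⁅ t ⁆) ≡ isClique (turan n0 r) X ∧ (X ⊑ᵇ L.lookup Ls t)
  clique-oneApex X t =
    InducedCopy.clique-apex G r inL inL-injective adjLL (X ++ᵛ ⁅ t ⁆) X (lookup-++ˡ X ⁅ t ⁆)
      (inR t) (trans (lookup-++ʳ X ⁅ t ⁆ t) (lookup-⁅⁆-self t)) (λ x → inL≢inR x t)
      (L.lookup Ls t) (λ x → adjLR x t) (λ x → adjRL x t) cover
    where
    cover : ∀ w → (∃ λ x → w ≡ inL x) ⊎ w ≡ inR t ⊎ lookup (X ++ᵛ ⁅ t ⁆) w ≡ false
    cover w with vertex w
    ... | inj₁ p = inj₁ p
    ... | inj₂ (u , refl) with u ≟ᶠ t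
    ...   | yes refl = inj₂ (inj₁ refl)
    ...   | no ne    = inj₂ (inj₂ (trans (lookup-++ʳ X ⁅ t ⁆ u) (lookup-⁅⁆-other t u ne)))

  clique-twoApexes : (X : Subset n0) (Y : Subset L′) (i j : Fin L′) →
    lookup Y i ≡ true → lookup Y j ≡ true → i ≢ j → isClique G (X ++ᵛ Y) ≡ false
  clique-twoApexes X Y i j yi yj ne with isClique G (X ++ᵛ Y) in e
  ... | false = refl
  ... | true  = sym (trans (sym (adjRR i j)) (isClique-sound G (X ++ᵛ Y) e (inR i) (inR j)
                  (trans (lookup-++ʳ X Y i) yi) (trans (lookup-++ʳ X Y j) yj) (ne ∘ inR-injective)))

  cone-faces : ∀ j → faces G (suc j) ≡ binomT n0 (suc j) r + sum (map (λ N → cliquesIn n0 r N j) Ls)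
  cone-faces j = begin
    faces G (suc j)
      ≡⟨ count≡sumSub (n0 + L′) _ ⟩
    sumSub (n0 + L′) F
      ≡⟨ sumSub-++ n0 L′ F ⟩
    sumSub n0 (λ X → sumSub L′ (λ Y → F (X ++ᵛ Y)))
      ≡⟨ sumSub-cong n0 (λ X → sumSub-atMostOne L′ _ (twoApexes X)) ⟩
    sumSub n0 (λ X → F (X ++ᵛ ∅) + sumFin L′ (λ t → F (X ++ᵛ ⁅ t ⁆)))
      ≡⟨ sumSub-cong n0 (λ X → cong₂ _+_ (noApex X) (sumFin-cong L′ (oneApex X))) ⟩
    sumSub n0 (λ X → indicator ((∣ X ∣ ≡ᵇ suc j) ∧ isClique (turan n0 r) X)
                     + sumFin L′ (λ t → indicator ((∣ X ∣ ≡ᵇ j) ∧ isClique (turan n0 r) X ∧ (X ⊑ᵇ L.lookup Ls t))))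
      ≡⟨ sumSub-+ n0 _ _ ⟩
    _ + sumSub n0 (λ X → sumFin L′ (λ t → _))
      ≡⟨ cong₂ _+_ (sym (binomT-sumSub n0 (suc j) r))
                   (trans (sumSub-sumFin n0 L′ _) (sumFin-lookup (λ N → cliquesIn n0 r N j) Ls)) ⟩
    binomT n0 (suc j) r + sum (map (λ N → cliquesIn n0 r N j) Ls) ∎
    where
    open ≡-Reasoning
    F : Subset (n0 + L′) → ℕ
    F S = indicator ((∣ S ∣ ≡ᵇ suc j) ∧ isClique G S)
    twoApexes : ∀ X Y i k → lookup Y i ≡ true → lookup Y k ≡ true → i ≢ k → F (X ++ᵛ Y) ≡ 0
    twoApexes X Y i k yi yk ne rewrite clique-twoApexes X Y i k yi yk ne | ∧-zeroʳ (∣ X ++ᵛ Y ∣ ≡ᵇ suc j) = refl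
    noApex : ∀ X → F (X ++ᵛ ∅) ≡ indicator ((∣ X ∣ ≡ᵇ suc j) ∧ isClique (turan n0 r) X)
    noApex X rewrite clique-noApex X | ∣++∣ X (∅ {L′}) | ∣⊥∣≡0 L′ | +-identityʳ ∣ X ∣ = refl
    oneApex : ∀ X t → F (X ++ᵛ ⁅ t ⁆) ≡ indicator ((∣ X ∣ ≡ᵇ j) ∧ isClique (turan n0 r) X ∧ (X ⊑ᵇ L.lookup Ls t))
    oneApex X t rewrite clique-oneApex X t | ∣++∣ X ⁅ t ⁆ | ∣⁅x⁆∣≡1 t | +-comm ∣ X ∣ 1 = refl

-- In T_{n+1,r} the last vertex n is adjacent to the
-- vertices of T_{n,r} outside its part; call this set lastNbhd n r.

lastNbhd : (n r : ℕ) → Subset n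
lastNbhd n r = tabulate (λ x → not (part r (toℕ x) ≡ᵇ part r n))

private
  lookup-∷ʳ-inject₁ : ∀ {n} (X : Subset n) b (x : Fin n) → lookup (X ∷ʳ b) (inject₁ x) ≡ lookup X x
  lookup-∷ʳ-inject₁ (a ∷ X) b zero    = refl
  lookup-∷ʳ-inject₁ (a ∷ X) b (suc x) = lookup-∷ʳ-inject₁ X b x

  lookup-∷ʳ-last : ∀ {n} (X : Subset n) b → lookup (X ∷ʳ b) (fromℕ n) ≡ b
  lookup-∷ʳ-last []      b = refl
  lookup-∷ʳ-last (a ∷ X) b = lookup-∷ʳ-last X b

  inject₁-or-last : ∀ {n} (w : Fin (suc n)) → (∃ λ x → w ≡ inject₁ x) ⊎ w ≡ fromℕ n
  inject₁-or-last {zero}  zero = inj₂ refl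
  inject₁-or-last {suc n} zero = inj₁ (zero , refl)
  inject₁-or-last {suc n} (suc w) with inject₁-or-last w
  ... | inj₁ (x , refl) = inj₁ (suc x , refl)
  ... | inj₂ refl       = inj₂ refl

  module LastVertex (n r : ℕ) (X : Subset n) where
    G : Graph
    G = turan (suc n) r

    adj-inject₁ : ∀ x y → adj G (inject₁ x) (inject₁ y) ≡ turanAdj r x y
    adj-inject₁ x y = cong₂ (λ a b → not (part r a ≡ᵇ part r b)) (toℕ-inject₁ x) (toℕ-inject₁ y)

    without : isClique G (X ∷ʳ false) ≡ isClique (turan n r) X
    without = InducedCopy.clique-inside G r inject₁ inject₁-injective adj-inject₁ (X ∷ʳ false) X
                (lookup-∷ʳ-inject₁ X false) cover
      where
      cover : ∀ w → (∃ λ x → w ≡ inject₁ x) ⊎ lookup (X ∷ʳ false) w ≡ false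
      cover w with inject₁-or-last w
      ... | inj₁ p    = inj₁ p
      ... | inj₂ refl = inj₂ (lookup-∷ʳ-last X false)

    with-last : isClique G (X ∷ʳ true) ≡ isClique (turan n r) X ∧ (X ⊑ᵇ lastNbhd n r)
    with-last = InducedCopy.clique-apex G r inject₁ inject₁-injective adj-inject₁ (X ∷ʳ true) X
                  (lookup-∷ʳ-inject₁ X true) (fromℕ n) (lookup-∷ʳ-last X true) (λ x e → fromℕ≢inject₁ (sym e))
                  (lastNbhd n r) to-last from-last (λ w → map₂ inj₁ (inject₁-or-last w))
      where
      to-last : ∀ x → adj G (inject₁ x) (fromℕ n) ≡ lookup (lastNbhd n r) x
      to-last x = trans (cong₂ (λ a b → not (part r a ≡ᵇ part r b)) (toℕ-inject₁ x) (toℕ-fromℕ n))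
                        (sym (lookup∘tabulate _ x))
      from-last : ∀ x → adj G (fromℕ n) (inject₁ x) ≡ lookup (lastNbhd n r) x
      from-last x = trans (cong₂ (λ a b → not (part r a ≡ᵇ part r b)) (toℕ-fromℕ n) (toℕ-inject₁ x))
                          (trans (cong not (≡ᵇ-sym (part r n) (part r (toℕ x)))) (sym (lookup∘tabulate _ x)))

turan-recursion : ∀ n r j → binomT (suc n) (suc j) r ≡ binomT n (suc j) r + cliquesIn n r (lastNbhd n r) j
turan-recursion n r j = begin
  binomT (suc n) (suc j) r
    ≡⟨ count≡sumSub (suc n) _ ⟩
  sumSub (suc n) F
    ≡⟨ sumSub-∷ʳ n F ⟩
  sumSub n (λ X → F (X ∷ʳ true)) + sumSub n (λ X → F (X ∷ʳ false))
    ≡⟨ cong₂ _+_ (sumSub-cong n with-last) (trans (sumSub-cong n without) (sym (binomT-sumSub n (suc j) r))) ⟩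
  cliquesIn n r (lastNbhd n r) j + binomT n (suc j) r
    ≡⟨ +-comm (cliquesIn n r (lastNbhd n r) j) _ ⟩
  binomT n (suc j) r + cliquesIn n r (lastNbhd n r) j ∎
  where
  open ≡-Reasoning
  F : Subset (suc n) → ℕ
  F S = indicator ((∣ S ∣ ≡ᵇ suc j) ∧ isClique (turan (suc n) r) S)
  with-last : ∀ X → F (X ∷ʳ true) ≡ indicator ((∣ X ∣ ≡ᵇ j) ∧ isClique (turan n r) X ∧ (X ⊑ᵇ lastNbhd n r))
  with-last X rewrite LastVertex.with-last n r X | ∣∷ʳ∣ X true | +-comm ∣ X ∣ 1 = refl
  without : ∀ X → F (X ∷ʳ false) ≡ indicator ((∣ X ∣ ≡ᵇ suc j) ∧ isClique (turan n r) X)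
  without X rewrite LastVertex.without n r X | ∣∷ʳ∣ X false | +-identityʳ ∣ X ∣ = refl

private
  ∣∣-tabulate : ∀ {A : Set} {n} (S : Subset n) (g : Fin n → A) (p : A → Bool) →
    (∀ i → p (g i) ≡ lookup S i) → ∣ S ∣ ≡ length (filterᵇ p (L.tabulate g))
  ∣∣-tabulate []      g p h = refl
  ∣∣-tabulate (b ∷ S) g p h with p (g zero) | h zero
  ... | true  | refl = cong suc (∣∣-tabulate S (g ∘ suc) p (h ∘ suc))
  ... | false | refl = ∣∣-tabulate S (g ∘ suc) p (h ∘ suc)

∣∣≡length-elements : ∀ {n} (S : Subset n) → ∣ S ∣ ≡ length (filterᵇ (lookup S) (allFin n))
∣∣≡length-elements S = ∣∣-tabulate S id (lookup S) (λ i → refl)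

∣∣-by-relation : ∀ {n m} (X : Subset n) (Y : Subset m) (R : Fin n → Fin m → Set) →
  (∀ {x x' y} → R x y → R x' y → x ≡ x') → (∀ {x y y'} → R x y → R x y' → y ≡ y') →
  (∀ x → lookup X x ≡ true → ∃ λ y → lookup Y y ≡ true × R x y) →
  (∀ y → lookup Y y ≡ true → ∃ λ x → lookup X x ≡ true × R x y) →
  ∣ X ∣ ≡ ∣ Y ∣
∣∣-by-relation {n} {m} X Y R inj₁' inj₂' total₁ total₂ =
  trans (∣∣≡length-elements X)
    (trans (count-≡-by-relation R (allFin n) (allFin m) (Unique.allFin⁺ n) (Unique.allFin⁺ m) (lookup X) (lookup Y)
              (λ _ _ _ → inj₁') (λ _ _ _ → inj₂')
              (λ {x} _ px → let (y , py , r) = total₁ x px in y , ∈-allFin y , py , r)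
              (λ {y} _ py → let (x , px , r) = total₂ y py in x , ∈-allFin x , px , r))
           (sym (∣∣≡length-elements Y)))

vec-ext : ∀ {A : Set} {n} (X Y : Vec A n) → (∀ i → lookup X i ≡ lookup Y i) → X ≡ Y
vec-ext X Y h = trans (sym (tabulate∘lookup X)) (trans (tabulate-cong h) (tabulate∘lookup Y))

-- If N induces a copy of T_{n,s} in T_{n0,r},
-- then the j-cliques of T_{n0,r} inside N correspond to the j-cliques of
-- T_{n,s}: pull back along the embedding e (pre) and push forward (img).

module InducedCount {n0 r n s : ℕ} {N : Subset n0} (copy : InducesTuran n0 r n s N) where

  private
    e : Fin n → Fin n0
    e = proj₁ copy
    e-injective : ∀ {a b} → e a ≡ e b → a ≡ b
    e-injective = proj₁ (proj₂ copy)
    e-onto : (x : Fin n0) → (x ∈ˢ N) ⇔ (∃ λ y → e y ≡ x)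
    e-onto = proj₁ (proj₂ (proj₂ copy))
    e-adj : (y₁ y₂ : Fin n) → turanAdj r (e y₁) (e y₂) ≡ turanAdj s y₁ y₂
    e-adj = proj₂ (proj₂ (proj₂ copy))

    N-image : ∀ x → lookup N x ≡ true → ∃ λ y → e y ≡ x
    N-image x p = Equivalence.to (e-onto x) (lookup⇒[]= x N p)

    e-in-N : ∀ y → lookup N (e y) ≡ true
    e-in-N y = []=⇒lookup (Equivalence.from (e-onto (e y)) (y , refl))

    T0 T′ : Graph
    T0 = turan n0 r
    T′ = turan n s

    pre : Subset n0 → Subset n
    pre X = tabulate (λ y → lookup X (e y))

    lookup-pre : ∀ X y → lookup (pre X) y ≡ lookup X (e y)
    lookup-pre X y = lookup∘tabulate _ y

    witness? : (Y : Subset n) (x : Fin n0) (y : Fin n) → Dec (e y ≡ x × lookup Y y ≡ true)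
    witness? Y x y = (e y ≟ᶠ x) ×-dec (lookup Y y ≟ᵇ true)

    img : Subset n → Subset n0
    img Y = tabulate (λ x → does (any? (witness? Y x)))

    img-elim : ∀ Y x → lookup (img Y) x ≡ true → ∃ λ y → e y ≡ x × lookup Y y ≡ true
    img-elim Y x p rewrite lookup∘tabulate (λ x → does (any? (witness? Y x))) x with any? (witness? Y x)
    ... | yes q = q

    img-intro : ∀ Y y → lookup Y y ≡ true → lookup (img Y) (e y) ≡ true
    img-intro Y y p rewrite lookup∘tabulate (λ x → does (any? (witness? Y x))) (e y) with any? (witness? Y (e y))
    ... | yes _ = refl
    ... | no np = ⊥-elim (np (y , refl , p))

    ∣pre∣ : ∀ X → X ⊑ N → ∣ pre X ∣ ≡ ∣ X ∣
    ∣pre∣ X X⊑N = sym (∣∣-by-relation X (pre X) (λ x y → e y ≡ x) (λ a b → trans (sym a) b)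
      (λ a b → e-injective (trans a (sym b)))
      (λ x px → let (y , ey) = N-image x (X⊑N x px) in y , trans (lookup-pre X y) (trans (cong (lookup X) ey) px) , ey)
      (λ y py → e y , trans (sym (lookup-pre X y)) py , refl))

    pre-img : ∀ Y → pre (img Y) ≡ Y
    pre-img Y = vec-ext _ _ (λ y → trans (lookup-pre (img Y) y) (bool-ext
      (λ p → let (y' , ey , py) = img-elim Y (e y) p in subst (λ z → lookup Y z ≡ true) (e-injective ey) py)
      (img-intro Y y)))

    img⊑N : ∀ Y → img Y ⊑ N
    img⊑N Y x p = let (y , ey , _) = img-elim Y x p in subst (λ z → lookup N z ≡ true) ey (e-in-N y)

    img-pre : ∀ X → X ⊑ N → img (pre X) ≡ X
    img-pre X X⊑N = vec-ext _ _ (λ x → bool-ext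
      (λ p → let (y , ey , py) = img-elim (pre X) x p in
             subst (λ z → lookup X z ≡ true) ey (trans (sym (lookup-pre X y)) py))
      (λ p → let (y , ey) = N-image x (X⊑N x p) in
             subst (λ z → lookup (img (pre X)) z ≡ true) ey
               (img-intro (pre X) y (trans (lookup-pre X y) (trans (cong (lookup X) ey) p)))))

    ∣img∣ : ∀ Y → ∣ img Y ∣ ≡ ∣ Y ∣
    ∣img∣ Y = trans (sym (∣pre∣ (img Y) (img⊑N Y))) (cong ∣_∣ (pre-img Y))

    clique-pre : ∀ X → IsClique T0 X → IsClique T′ (pre X)
    clique-pre X c y₁ y₂ p₁ p₂ ne =
      trans (sym (e-adj y₁ y₂)) (c (e y₁) (e y₂) (trans (sym (lookup-pre X y₁)) p₁) (trans (sym (lookup-pre X y₂)) p₂)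
                                  (ne ∘ e-injective))

    clique-img : ∀ Y → IsClique T′ Y → IsClique T0 (img Y)
    clique-img Y c x₁ x₂ p₁ p₂ ne with img-elim Y x₁ p₁ | img-elim Y x₂ p₂
    ... | y₁ , refl , q₁ | y₂ , refl , q₂ = trans (e-adj y₁ y₂) (c y₁ y₂ q₁ q₂ (λ { refl → ne refl }))

  cliquesIn-copy : ∀ j → cliquesIn n0 r N j ≡ binomT n j s
  cliquesIn-copy j =
    trans (sym (count≡sumSub n0 P))
      (count-≡-by-relation (λ X Y → pre X ≡ Y) (allSubsets n0) (allSubsets n) (allSubsets-unique n0) (allSubsets-unique n) P Q
        (λ {X} {X'} px px' _ a b → trans (sym (img-pre X (P⇒⊑ X px))) (trans (cong img (trans a (sym b))) (img-pre X' (P⇒⊑ X' px'))))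
        (λ _ _ _ a b → trans (sym a) b)
        (λ {X} _ px → pre X , allSubsets-complete n (pre X) , P⇒Q-pre X px , refl)
        (λ {Y} _ qy → img Y , allSubsets-complete n0 (img Y) , Q⇒P-img Y qy , pre-img Y))
    where
    P : Subset n0 → Bool
    P X = (∣ X ∣ ≡ᵇ j) ∧ isClique T0 X ∧ (X ⊑ᵇ N)
    Q : Subset n → Bool
    Q Y = (∣ Y ∣ ≡ᵇ j) ∧ isClique T′ Y

    P⇒⊑ : ∀ X → P X ≡ true → X ⊑ N
    P⇒⊑ X p = ⊑ᵇ-sound X N (∧-elimʳ {isClique T0 X} (∧-elimʳ {∣ X ∣ ≡ᵇ j} p))

    P⇒Q-pre : ∀ X → P X ≡ true → Q (pre X) ≡ true
    P⇒Q-pre X p =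
      ∧-intro (trans (cong (_≡ᵇ j) (∣pre∣ X (P⇒⊑ X p))) (∧-elimˡ p))
              (isClique-complete T′ (pre X) (clique-pre X (isClique-sound T0 X (∧-elimˡ (∧-elimʳ {∣ X ∣ ≡ᵇ j} p)))))

    Q⇒P-img : ∀ Y → Q Y ≡ true → P (img Y) ≡ true
    Q⇒P-img Y q =
      ∧-intro (trans (cong (_≡ᵇ j) (∣img∣ Y)) (∧-elimˡ q))
              (∧-intro (isClique-complete T0 (img Y) (clique-img Y (isClique-sound T′ Y (∧-elimʳ {∣ Y ∣ ≡ᵇ j} q))))
                       (⊑ᵇ-complete (img Y) N (img⊑N Y)))

imageSet : ∀ {n m} → (Fin n → Fin m) → Subset m
imageSet e = tabulate (λ x → does (any? (λ y → e y ≟ᶠ x)))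

imageSet-spec : ∀ {n m} (e : Fin n → Fin m) (x : Fin m) → (x ∈ˢ imageSet e) ⇔ (∃ λ y → e y ≡ x)
imageSet-spec e x = mk⇔ to from
  where
  to : x ∈ˢ imageSet e → ∃ λ y → e y ≡ x
  to p with trans (sym (lookup∘tabulate (λ x → does (any? (λ y → e y ≟ᶠ x))) x)) ([]=⇒lookup p)
  ... | q with any? (λ y → e y ≟ᶠ x)
  ...   | yes w = w
  from : (∃ λ y → e y ≡ x) → x ∈ˢ imageSet e
  from (y , ey) = lookup⇒[]= x (imageSet e) (trans (lookup∘tabulate (λ x → does (any? (λ y → e y ≟ᶠ x))) x) found)
    where
    found : does (any? (λ y → e y ≟ᶠ x)) ≡ true
    found with any? (λ y → e y ≟ᶠ x)
    ... | yes _ = refl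
    ... | no np = ⊥-elim (np (y , ey))

imageSet-⊑ : ∀ {n m} (e : Fin n → Fin m) (N : Subset m) → (∀ y → lookup N (e y) ≡ true) → imageSet e ⊑ N
imageSet-⊑ e N h x p with Equivalence.to (imageSet-spec e x) (lookup⇒[]= x (imageSet e) p)
... | y , refl = h y

-- Skipping one residue: skip c maps {0..k-1} injectively into {0..k}∖{c}.

skip : ℕ → ℕ → ℕ
skip c t with t <? c
... | yes _ = t
... | no _  = suc t

skip-≤ : ∀ c t → skip c t ≤ suc t
skip-≤ c t with t <? c
... | yes _ = n≤1+n t
... | no _  = ≤-refl

skip-below : ∀ c t → t < c → skip c t ≡ t
skip-below c t lt with t <? c
... | yes _   = refl
... | no nlt  = ⊥-elim (nlt lt)

skip-≢ : ∀ c t → skip c t ≢ c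
skip-≢ c t e with t <? c
... | yes lt  = <-irrefl e lt
... | no nlt  = nlt (≤-reflexive e)

skip-injective : ∀ c t u → skip c t ≡ skip c u → t ≡ u
skip-injective c t u e with t <? c | u <? c
... | yes _  | yes _  = e
... | no _   | no _   = suc-injective e
... | yes tc | no uc  = ⊥-elim (uc (<-trans (n<1+n u) (subst (_< c) e tc)))
... | no tc  | yes uc = ⊥-elim (tc (<-trans (n<1+n t) (subst (_< c) (sym e) uc)))

-- Embedding T_{n',k} into the neighbourhood of the last vertex of T_{n+1,k+1}
-- (k = s'+1), for n' ≤ n - ⌊n/(k+1)⌋.  Vertex y, in part y mod k, goes to
-- vertex skip c (y mod k) + ⌊y/k⌋(k+1), where c = n mod (k+1) is the part of
-- the last vertex: the residue classes mod k are spread over the parts of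
-- T_{n,k+1} other than c, keeping the row index ⌊y/k⌋.

module Spread (s' n : ℕ) where
  k M q c : ℕ
  k = suc s'
  M = suc k
  q = n / M
  c = n % M

  spread : ℕ → ℕ
  spread y = skip c (y % k) + (y / k) * M

  private
    c≤k : c ≤ k
    c≤k = <⇒≤pred (m%n<n n M)

    n≡ : n ≡ c + q * M
    n≡ = m≡m%n+[m/n]*n n M

    n∸q≡ : n ∸ q ≡ c + q * k
    n∸q≡ = begin
      n ∸ q               ≡⟨ cong (_∸ q) n≡ ⟩
      (c + q * M) ∸ q     ≡⟨ cong (λ z → (c + z) ∸ q) (*-suc q k) ⟩
      (c + (q + q * k)) ∸ q ≡⟨ cong (_∸ q) (trans (sym (+-assoc c q (q * k)))
                                  (trans (cong (_+ q * k) (+-comm c q)) (+-assoc q c (q * k)))) ⟩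
      (q + (c + q * k)) ∸ q ≡⟨ m+n∸m≡n q (c + q * k) ⟩
      c + q * k ∎
      where open ≡-Reasoning

    -- rows below q fit in the first q complete rows of T_{n,k+1}
    spread-full-row : ∀ y → y / k < q → spread y < n
    spread-full-row y a<q = begin-strict
      skip c (y % k) + (y / k) * M ≤⟨ +-monoˡ-≤ ((y / k) * M) (≤-trans (skip-≤ c (y % k)) (m%n<n y k)) ⟩
      k + (y / k) * M            <⟨ ≤-refl ⟩
      M + (y / k) * M            ≤⟨ *-monoˡ-≤ M a<q ⟩
      q * M                      ≤⟨ m≤n+m (q * M) c ⟩
      c + q * M                  ≡⟨ sym n≡ ⟩
      n ∎
      where open ≤-Reasoning

    -- in the last, incomplete row only residues below c occur
    spread-last-row : ∀ y → y < n ∸ q → q ≤ y / k → spread y < n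
    spread-last-row y y< q≤a = subst (λ z → z + a * M < n) (sym (skip-below c t t<c))
        (≤-trans (+-monoʳ-≤ (suc t) (*-monoˡ-≤ M a≤q)) (≤-trans (+-monoˡ-≤ (q * M) t<c) (≤-reflexive (sym n≡))))
      where
      t a : ℕ
      t = y % k
      a = y / k
      y<′ : t + a * k < c + q * k
      y<′ = subst (_< c + q * k) (m≡m%n+[m/n]*n y k) (subst (y <_) n∸q≡ y<)
      t<c : t < c
      t<c = +-cancelʳ-< (q * k) t c (≤-<-trans (+-monoʳ-≤ t (*-monoˡ-≤ k q≤a)) y<′)
      a≤q : a ≤ q
      a≤q with a ≤? q
      ... | yes p = p
      ... | no p  = ⊥-elim (<-irrefl refl (<-≤-trans y<′ (≤-trans (+-monoˡ-≤ (q * k) c≤k)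
                      (≤-trans (*-monoˡ-≤ k (≰⇒> p)) (m≤n+m (a * k) t)))))

  spread-< : ∀ y → y < n ∸ q → spread y < n
  spread-< y y< with (y / k) <? q
  ... | yes a<q = spread-full-row y a<q
  ... | no a≮q  = spread-last-row y y< (≮⇒≥ a≮q)

  spread-part : ∀ y → spread y % M ≡ skip c (y % k)
  spread-part y = trans ([m+kn]%n≡m%n (skip c (y % k)) (y / k) M)
                        (m<n⇒m%n≡m (s≤s (≤-trans (skip-≤ c (y % k)) (m%n<n y k))))

  spread-injective : ∀ y z → spread y ≡ spread z → y ≡ z
  spread-injective y z e = trans (m≡m%n+[m/n]*n y k) (trans (cong₂ (λ u v → u + v * k) same-part same-row)
                                                           (sym (m≡m%n+[m/n]*n z k)))
    where
    same-part : y % k ≡ z % k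
    same-part = skip-injective c _ _ (trans (sym (spread-part y)) (trans (cong (_% M) e) (spread-part z)))
    same-row : y / k ≡ z / k
    same-row = *-cancelʳ-≡ (y / k) (z / k) M (+-cancelˡ-≡ (skip c (y % k)) ((y / k) * M) ((z / k) * M)
                 (trans e (cong (λ u → u + (z / k) * M) (cong (skip c) (sym same-part)))))

  module _ (n' : ℕ) (n'≤ : n' ≤ n ∸ q) where
    embed : Fin n' → Fin n
    embed y = fromℕ< (spread-< (toℕ y) (<-≤-trans (toℕ<n y) n'≤))

    toℕ-embed : ∀ y → toℕ (embed y) ≡ spread (toℕ y)
    toℕ-embed y = toℕ-fromℕ< _

    part-embed : ∀ y → toℕ (embed y) % M ≡ skip c (toℕ y % k)
    part-embed y = trans (cong (_% M) (toℕ-embed y)) (spread-part (toℕ y))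

    embed-injective : ∀ {y z} → embed y ≡ embed z → y ≡ z
    embed-injective {y} {z} p =
      toℕ-injective (spread-injective (toℕ y) (toℕ z) (trans (sym (toℕ-embed y)) (trans (cong toℕ p) (toℕ-embed z))))

    embed-adj : ∀ y z → turanAdj M (embed y) (embed z) ≡ turanAdj k y z
    embed-adj y z = cong not (trans (cong₂ _≡ᵇ_ (part-embed y) (part-embed z))
      (bool-ext (λ p → ≡ᵇ-complete (skip-injective c _ _ (≡ᵇ-sound p)))
                (λ p → ≡ᵇ-complete (cong (skip c) (≡ᵇ-sound p)))))

    embed-lastNbhd : ∀ y → lookup (lastNbhd n M) (embed y) ≡ true
    embed-lastNbhd y = trans (lookup∘tabulate _ (embed y))
      (cong not (trans (cong (_≡ᵇ c) (part-embed y)) (≡ᵇ-false (skip-≢ c _))))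

-- For n' ≤ n - ⌊n/r⌋ (r = s+1), some vertex set of T_{n,r} inducing a copy of
-- T_{n',s} lies in the neighbourhood of the next vertex n of T_{n+1,r}.
-- (For s = 0 the bound forces n' = 0.)
copyInLastNbhd : ∀ s n n' → n' ≤ n ∸ (n div suc s) →
  Σ (Subset n) λ N → InducesTuran n (suc s) n' s N × N ⊑ lastNbhd n (suc s)
copyInLastNbhd zero n n' n'≤ =
  imageSet e , (e , (λ {y} → ⊥-elim (no-vertex y)) , imageSet-spec e , λ y → ⊥-elim (no-vertex y)) ,
  imageSet-⊑ e (lastNbhd n 1) (λ y → ⊥-elim (no-vertex y))
  where
  n'≡0 : n' ≡ 0
  n'≡0 = n≤0⇒n≡0 (≤-trans n'≤ (≤-reflexive (trans (cong (n ∸_) (n/1≡n n)) (n∸n≡0 n))))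
  no-vertex : Fin n' → ⊥
  no-vertex y = n≮0 (subst (toℕ y <_) n'≡0 (toℕ<n y))
  e : Fin n' → Fin n
  e y = ⊥-elim (no-vertex y)
copyInLastNbhd (suc s') n n' n'≤ =
  imageSet e , (e , embed-injective n' n'≤ , imageSet-spec e , embed-adj n' n'≤) ,
  imageSet-⊑ e (lastNbhd n (suc (suc s'))) (embed-lastNbhd n' n'≤)
  where
  open Spread s' n
  e : Fin n' → Fin n
  e = embed n' n'≤

cliquesIn-mono : ∀ n r (N N' : Subset n) j → N ⊑ N' → cliquesIn n r N j ≤ cliquesIn n r N' j
cliquesIn-mono n r N N' j N⊑N' = sumSub-mono n term
  where
  term : ∀ X → indicator ((∣ X ∣ ≡ᵇ j) ∧ isClique (turan n r) X ∧ (X ⊑ᵇ N))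
             ≤ indicator ((∣ X ∣ ≡ᵇ j) ∧ isClique (turan n r) X ∧ (X ⊑ᵇ N'))
  term X with X ⊑ᵇ N in e
  ... | false rewrite ∧-zeroʳ (isClique (turan n r) X) | ∧-zeroʳ (∣ X ∣ ≡ᵇ j) = z≤n
  ... | true  rewrite ⊑ᵇ-complete X N' (λ x p → N⊑N' x (⊑ᵇ-sound X N e x p)) = ≤-refl

turan-step : ∀ s n n' j → n' ≤ n ∸ (n div suc s) →
  binomT n (suc j) (suc s) + binomT n' j s ≤ binomT (suc n) (suc j) (suc s)
turan-step s n n' j n'≤ with copyInLastNbhd s n n' n'≤
... | N , copy , N⊑ = begin
  binomT n (suc j) (suc s) + binomT n' j s
    ≡⟨ cong (binomT n (suc j) (suc s) +_) (sym (InducedCount.cliquesIn-copy {n} {suc s} {n'} {s} {N} copy j)) ⟩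
  binomT n (suc j) (suc s) + cliquesIn n (suc s) N j
    ≤⟨ +-monoʳ-≤ _ (cliquesIn-mono n (suc s) N _ j N⊑) ⟩
  binomT n (suc j) (suc s) + cliquesIn n (suc s) (lastNbhd n (suc s)) j
    ≡⟨ sym (turan-recursion n (suc s) j) ⟩
  binomT (suc n) (suc j) (suc s) ∎
  where open ≤-Reasoning

binomT-mono : ∀ q r {n n'} → n ≤ n' → binomT n (suc q) r ≤ binomT n' (suc q) r
binomT-mono q r {n} {zero} z≤n = ≤-refl
binomT-mono q r {n} {suc n'} n≤ with n ≤? n'
... | yes p = ≤-trans (binomT-mono q r p) (≤-trans (m≤m+n _ _) (≤-reflexive (sym (turan-recursion n' r q))))
... | no np = ≤-reflexive (cong (λ z → binomT z (suc q) r) (≤-antisym n≤ (≰⇒> np)))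

module Greedy (f : ℕ → ℕ) (f-mono : ∀ {n n'} → n ≤ n' → f n ≤ f n') where
  below : ∀ {x n b} → f n ≤ x → x < f (suc b) → n ≤ b
  below {x} {n} {b} fn≤x x<fb with n ≤? b
  ... | yes p = p
  ... | no np = ⊥-elim (<-irrefl refl (<-≤-trans x<fb (≤-trans (f-mono (≰⇒> np)) fn≤x)))

  unique : ∀ {x n₁ n₂} → f n₁ ≤ x → x < f (suc n₁) → f n₂ ≤ x → x < f (suc n₂) → n₁ ≡ n₂
  unique a b c d = ≤-antisym (below a d) (below c b)

tail-sum : ∀ {k r m ns} → Tail k r m ns → sum (map (λ n → binomT n (k ∸ 1) (r ∸ 1)) ns) ≡ m
tail-sum tail-stop = refl
tail-sum {k} {r} (tail-step {m} {n} _ le _ t) = trans (cong (binomT n (k ∸ 1) (r ∸ 1) +_) (tail-sum t)) (m+[n∸m]≡n le)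

-- Tails and the recursion defining d^k_{p,r} make the same greedy choices (k ≥ 2).
module GreedyTail (p r k' : ℕ) where
  private
    k : ℕ
    k = suc (suc k')
    f : ℕ → ℕ
    f n = binomT n (suc k') (r ∸ 1)
  open Greedy f (binomT-mono k' (r ∸ 1))

  tail-d : ∀ {m ns d} → Tail k r m ns → DRel p r k m d → sum (map (λ n → binomT n (p ∸ 1) (r ∸ 1)) ns) ≡ d
  tail-d tail-stop d-zero = refl
  tail-d tail-stop (d-step () _ _ _)
  tail-d (tail-step () _ _ _) d-zero
  tail-d (tail-step {m} {n} _ le lt t) (d-step {j = j} _ le' lt' D) with unique {m} {n} {j} le lt le' lt'
  ... | refl = cong (binomT n (p ∸ 1) (r ∸ 1) +_) (tail-d t D)

  indices : ∀ {m d} → DRel p r k m d → List ℕ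
  indices d-zero = []
  indices (d-step {j = j} _ _ _ D) = j ∷ indices D

  indices-tail : ∀ {m d} (D : DRel p r k m d) → Tail k r m (indices D)
  indices-tail d-zero = tail-stop
  indices-tail (d-step pos le lt D) = tail-step pos le lt (indices-tail D)

  indices-≤ : ∀ {m d} (D : DRel p r k m d) → ∀ b → m < f (suc b) → All (_≤ b) (indices D)
  indices-≤ d-zero b lt = []
  indices-≤ (d-step {m} {j} _ le _ D) b lt = below le lt ∷ indices-≤ D b (≤-<-trans (m∸n≤m m (f j)) lt)

private
  ⊑-∣∣-≡ : ∀ {n} (X E : Subset n) → X ⊑ E → ∣ X ∣ ≡ ∣ E ∣ → X ≡ E
  ⊑-∣∣-≡ []          []          s e = refl
  ⊑-∣∣-≡ (true ∷ X)  (true ∷ E)  s e = cong (true ∷_) (⊑-∣∣-≡ X E (s ∘ suc) (suc-injective e))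
  ⊑-∣∣-≡ (false ∷ X) (false ∷ E) s e = cong (false ∷_) (⊑-∣∣-≡ X E (s ∘ suc) e)
  ⊑-∣∣-≡ (true ∷ X)  (false ∷ E) s e = ⊥-elim (true≢false (sym (s zero refl)))
  ⊑-∣∣-≡ (false ∷ X) (true ∷ E)  s e = ⊥-elim (<-irrefl e (s≤s (p⊆q⇒∣p∣≤∣q∣ (⊑⇒⊆ {X = X} {N = E} (s ∘ suc)))))

cliquesIn-large : ∀ n r (E : Subset n) j → ∣ E ∣ < j → cliquesIn n r E j ≡ 0
cliquesIn-large n r E j ∣E∣<j = sumSub-zero n term
  where
  term : ∀ X → indicator ((∣ X ∣ ≡ᵇ j) ∧ isClique (turan n r) X ∧ (X ⊑ᵇ E)) ≡ 0
  term X with X ⊑ᵇ E in e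
  ... | false rewrite ∧-zeroʳ (isClique (turan n r) X) | ∧-zeroʳ (∣ X ∣ ≡ᵇ j) = refl
  ... | true  rewrite ≡ᵇ-false {∣ X ∣} {j}
          (λ q → <-irrefl q (≤-<-trans (p⊆q⇒∣p∣≤∣q∣ (⊑⇒⊆ {X = X} {N = E} (⊑ᵇ-sound X E e))) ∣E∣<j)) = refl

cliquesIn-itself : ∀ n r (E : Subset n) j → ∣ E ∣ ≡ j → isClique (turan n r) E ≡ true → cliquesIn n r E j ≡ 1
cliquesIn-itself n r E j ∣E∣≡j E-clique = trans (sumSub-point n E _ term) at-E
  where
  term : ∀ X → X ≢ E → indicator ((∣ X ∣ ≡ᵇ j) ∧ isClique (turan n r) X ∧ (X ⊑ᵇ E)) ≡ 0
  term X X≢E with X ⊑ᵇ E in e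
  ... | false rewrite ∧-zeroʳ (isClique (turan n r) X) | ∧-zeroʳ (∣ X ∣ ≡ᵇ j) = refl
  ... | true  rewrite ≡ᵇ-false {∣ X ∣} {j} (λ q → X≢E (⊑-∣∣-≡ X E (⊑ᵇ-sound X E e) (trans q (sym ∣E∣≡j)))) = refl
  at-E : indicator ((∣ E ∣ ≡ᵇ j) ∧ isClique (turan n r) E ∧ (E ⊑ᵇ E)) ≡ 1
  at-E rewrite ∣E∣≡j | ≡ᵇ-complete {j} refl | E-clique | ⊑ᵇ-complete E E (λ x p → p) = refl

sum-map-++ : {A : Set} (f : A → ℕ) (xs ys : List A) → sum (map f (xs ++ ys)) ≡ sum (map f xs) + sum (map f ys)
sum-map-++ f xs ys = trans (cong sum (map-++ f xs ys)) (sum-++ (map f xs) (map f ys))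

sum-cliquesIn-nbhds : ∀ {n0 r ns Ns} → NbhdsOK n0 r ns Ns → ∀ j →
  sum (map (λ N → cliquesIn n0 r N j) Ns) ≡ sum (map (λ n → binomT n j (r ∸ 1)) ns)
sum-cliquesIn-nbhds [] j = refl
sum-cliquesIn-nbhds {n0} {r} {n ∷ ns} {N ∷ Ns} (copy ∷ rest) j =
  cong₂ _+_ (InducedCount.cliquesIn-copy {n0} {r} {n} {r ∸ 1} {N} copy j) (sum-cliquesIn-nbhds {n0} {r} {ns} {Ns} rest j)

sum-cliquesIn-extras-large : ∀ {n0 r p Es} → ExtrasOK n0 r p Es → ∀ j → p ∸ 1 < j →
  sum (map (λ E → cliquesIn n0 r E j) Es) ≡ 0
sum-cliquesIn-extras-large [] j lt = refl
sum-cliquesIn-extras-large {n0} {r} {p} {E ∷ Es} ((∣E∣ , _) ∷ rest) j lt =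
  cong₂ _+_ (cliquesIn-large n0 r E j (subst (_< j) (sym ∣E∣) lt)) (sum-cliquesIn-extras-large {n0} {r} {p} {Es} rest j lt)

sum-cliquesIn-extras-exact : ∀ {n0 r p Es} → ExtrasOK n0 r p Es →
  sum (map (λ E → cliquesIn n0 r E (p ∸ 1)) Es) ≡ length Es
sum-cliquesIn-extras-exact [] = refl
sum-cliquesIn-extras-exact {n0} {r} {p} {E ∷ Es} ((∣E∣ , E-clique) ∷ rest) =
  cong₂ _+_ (cliquesIn-itself n0 r E (p ∸ 1) ∣E∣ E-clique) (sum-cliquesIn-extras-exact {n0} {r} {p} {Es} rest)

-- Clique sizes.  A colouring of the vertices of a clique X by M colours in
-- which equally coloured vertices are non-adjacent is injective on X, so ∣X∣ ≤ M.
clique-≤-colours : ∀ {a R} (M : ℕ) (X : Subset a) → IsClique (turan a R) X →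
  (Colour : Fin a → Fin M → Set) →
  (∀ x → lookup X x ≡ true → ∃ λ c → Colour x c) →
  (∀ x x' c → Colour x c → Colour x' c → turanAdj R x x' ≡ false) →
  ∣ X ∣ ≤ M
clique-≤-colours {a} {R} M X X-clique Colour coloured independent = begin
  ∣ X ∣                                     ≡⟨ ∣∣≡length-elements X ⟩
  length (filterᵇ (lookup X) (allFin a))    ≤⟨ length-≤-by-relation Colour (filterᵇ (lookup X) (allFin a)) (allFin M)
                                                 (Unique.filter⁺ (T? ∘ lookup X) {xs = allFin a} (Unique.allFin⁺ a))
                                                 same-colour (λ {x} p → let (c , col) = coloured x (in-X p) in c , ∈-allFin c , col) ⟩
  length (allFin M)                          ≡⟨ length-tabulate id ⟩
  M ∎
  where
  open ≤-Reasoning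
  in-X : ∀ {x} → x ∈ₗ filterᵇ (lookup X) (allFin a) → lookup X x ≡ true
  in-X p = T⇒≡true (proj₂ (∈-filter⁻ (T? ∘ lookup X) {xs = allFin a} p))
  same-colour : ∀ {x x' c} → x ∈ₗ filterᵇ (lookup X) (allFin a) → x' ∈ₗ filterᵇ (lookup X) (allFin a) →
                Colour x c → Colour x' c → x ≡ x'
  same-colour {x} {x'} {c} p p' cx cx' with x ≟ᶠ x'
  ... | yes eq = eq
  ... | no ne  = ⊥-elim (true≢false (trans (sym (X-clique x x' (in-X p) (in-X p') ne)) (independent x x' c cx cx')))

-- Cliques of T_{a,R'+1} have at most R'+1 vertices (colour = part).
turan-clique-≤ : ∀ {a} (R' : ℕ) (X : Subset a) → IsClique (turan a (suc R')) X → ∣ X ∣ ≤ suc R'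
turan-clique-≤ {a} R' X X-clique = clique-≤-colours {a} {suc R'} (suc R') X X-clique (λ x c → toℕ c ≡ toℕ x % suc R')
  (λ x _ → fromℕ< (m%n<n (toℕ x) (suc R')) , toℕ-fromℕ< _)
  (λ x x' c e e' → cong not (trans (cong₂ _≡ᵇ_ (sym e) (sym e')) (≡ᵇ-complete {toℕ c} refl)))

-- Cliques of T_{a,R} inside a set inducing T_{n,R'+1} have at most R'+1
-- vertices (colour = part of the preimage).
nbhd-clique-≤ : ∀ {a R n R'} {N : Subset a} → InducesTuran a R n (suc R') N →
  ∀ X → IsClique (turan a R) X → X ⊑ N → ∣ X ∣ ≤ suc R'
nbhd-clique-≤ {a} {R} {n} {R'} {N} (e , _ , e-onto , e-adj) X X-clique X⊑N =
  clique-≤-colours {a} {R} (suc R') X X-clique Colour coloured independent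
  where
  Colour : Fin a → Fin (suc R') → Set
  Colour x c = ∃ λ y → e y ≡ x × toℕ c ≡ toℕ y % suc R'
  coloured : ∀ x → lookup X x ≡ true → ∃ (Colour x)
  coloured x p with Equivalence.to (e-onto x) (lookup⇒[]= x N (X⊑N x p))
  ... | y , ey = fromℕ< (m%n<n (toℕ y) (suc R')) , y , ey , toℕ-fromℕ< _
  independent : ∀ x x' c → Colour x c → Colour x' c → turanAdj R x x' ≡ false
  independent x x' c (y , refl , cy) (y' , refl , cy') =
    trans (e-adj y y') (cong not (trans (cong₂ _≡ᵇ_ (sym cy) (sym cy')) (≡ᵇ-complete {toℕ c} refl)))

initialSegment : (a t : ℕ) → Subset a
initialSegment zero    t       = []
initialSegment (suc a) zero    = false ∷ initialSegment a zero
initialSegment (suc a) (suc t) = true ∷ initialSegment a t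

∣initialSegment∣ : ∀ a t → t ≤ a → ∣ initialSegment a t ∣ ≡ t
∣initialSegment∣ zero    zero    z≤n      = refl
∣initialSegment∣ (suc a) zero    z≤n      = ∣initialSegment∣ a zero z≤n
∣initialSegment∣ (suc a) (suc t) (s≤s le) = cong suc (∣initialSegment∣ a t le)

initialSegment-< : ∀ a t (x : Fin a) → lookup (initialSegment a t) x ≡ true → toℕ x < t
initialSegment-< (suc a) zero    zero    ()
initialSegment-< (suc a) zero    (suc x) p = ⊥-elim (n≮0 (initialSegment-< a zero x p))
initialSegment-< (suc a) (suc t) zero    p = s≤s z≤n
initialSegment-< (suc a) (suc t) (suc x) p = s≤s (initialSegment-< a t x p)

initialSegment-clique : ∀ a R' t → t ≤ suc R' → isClique (turan a (suc R')) (initialSegment a t) ≡ true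
initialSegment-clique a R' t t≤ = isClique-complete (turan a (suc R')) (initialSegment a t) clique
  where
  clique : IsClique (turan a (suc R')) (initialSegment a t)
  clique x y px py ne =
    cong not (trans (cong₂ _≡ᵇ_ (m<n⇒m%n≡m (<-≤-trans (initialSegment-< a t x px) t≤))
                                (m<n⇒m%n≡m (<-≤-trans (initialSegment-< a t y py) t≤)))
                    (≡ᵇ-false (ne ∘ toℕ-injective)))

binomT-small : ∀ n q r → n < q → binomT n q r ≡ 0
binomT-small n q r n<q = trans (binomT-sumSub n q r) (sumSub-zero n term)
  where
  term : ∀ S → indicator ((∣ S ∣ ≡ᵇ q) ∧ isClique (turan n r) S) ≡ 0
  term S rewrite ≡ᵇ-false {∣ S ∣} {q} (λ e → <-irrefl e (≤-<-trans (∣p∣≤n S) n<q)) = refl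

SmallCliquesIn : (n0 R' : ℕ) → Subset n0 → Set
SmallCliquesIn n0 R' N = ∀ X → IsClique (turan n0 (suc R')) X → X ⊑ N → ∣ X ∣ ≤ R'

cone-dim : ∀ n0 R' (Ls : List (Subset n0)) → All (SmallCliquesIn n0 R') Ls → dimAtMost (cone n0 (suc R') Ls) (suc R')
cone-dim n0 R' Ls small S S-clique with V.splitAt n0 S
... | X , Y , refl with sizeCases Y
... | empty refl = begin
  ∣ X ++ᵛ ∅ ∣        ≡⟨ ∣++∣ X ∅ ⟩
  ∣ X ∣ + ∣ ∅ {length Ls} ∣ ≡⟨ cong (∣ X ∣ +_) (∣⊥∣≡0 (length Ls)) ⟩
  ∣ X ∣ + 0          ≡⟨ +-identityʳ ∣ X ∣ ⟩
  ∣ X ∣              ≤⟨ turan-clique-≤ R' X (isClique-sound (turan n0 (suc R')) X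
                          (trans (sym (Cone.clique-noApex n0 (suc R') Ls X)) S-clique)) ⟩
  suc R' ∎
  where open ≤-Reasoning
... | singleton t refl = begin
  ∣ X ++ᵛ ⁅ t ⁆ ∣    ≡⟨ ∣++∣ X ⁅ t ⁆ ⟩
  ∣ X ∣ + ∣ ⁅ t ⁆ ∣   ≡⟨ cong (∣ X ∣ +_) (∣⁅x⁆∣≡1 t) ⟩
  ∣ X ∣ + 1          ≡⟨ +-comm ∣ X ∣ 1 ⟩
  suc ∣ X ∣          ≤⟨ s≤s (All.lookup small (∈-lookup t) X (isClique-sound (turan n0 (suc R')) X (∧-elimˡ X-in))
                               (⊑ᵇ-sound X _ (∧-elimʳ {isClique (turan n0 (suc R')) X} X-in))) ⟩
  suc R' ∎
  where
  open ≤-Reasoning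
  X-in : isClique (turan n0 (suc R')) X ∧ (X ⊑ᵇ L.lookup Ls t) ≡ true
  X-in = trans (sym (Cone.clique-oneApex n0 (suc R') Ls X t)) S-clique
... | two i j yi yj i≢j = ⊥-elim (true≢false (trans (sym S-clique) (Cone.clique-twoApexes n0 (suc R') Ls X Y i j yi yj i≢j)))

-- The construction, for r = s'+2, k = k'+2 and p = p'+1 with p ≤ k-1 ≤ r-1,
-- and v = binom(a,k)_r + binom(b,k-1)_{r-1} + m as in the theorem.

module Construction (s' k' p' v w a b m d : ℕ) (p≤k' : p' ≤ k') (k'≤s' : k' ≤ s')
  (v≡ : v ≡ binomT a (suc (suc k')) (suc (suc s')) + binomT b (suc k') (suc s') + m)
  (b< : b < a ∸ (a div suc (suc s')))
  (m< : m < binomT (b ∸ (b div suc s')) k' s')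
  (D : DRel (suc p') (suc (suc s')) (suc (suc k')) m d)
  (w≥ : binomT a (suc p') (suc (suc s')) + binomT b p' (suc s') + d ≤ w) where

  private
    r r-1 k k-1 p : ℕ
    r = suc (suc s')
    r-1 = suc s'
    k = suc (suc k')
    k-1 = suc k'
    p = suc p'

    outer inner : ℕ → ℕ
    outer n = binomT n k r
    inner n = binomT n k-1 r-1

  open Greedy outer (binomT-mono k-1 r) using () renaming (unique to outer-unique)
  open Greedy inner (binomT-mono k' r-1) using () renaming (unique to inner-unique)
  open GreedyTail p r k' using (tail-d; indices; indices-tail; indices-≤)

  -- The greedy decomposition: n_0 = a and m_0 = binom(b,k-1)_{r-1} + m.

  inner-bracket : inner b + m < inner (suc b)
  inner-bracket = <-≤-trans (+-monoʳ-< (inner b) m<) (turan-step s' b (b ∸ (b div r-1)) k' ≤-refl)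

  v≡′ : v ≡ outer a + (inner b + m)
  v≡′ = trans v≡ (+-assoc (outer a) (inner b) m)

  outer-≤ : outer a ≤ v
  outer-≤ = subst (outer a ≤_) (sym v≡′) (m≤m+n (outer a) (inner b + m))

  outer-< : v < outer (suc a)
  outer-< = begin-strict
    v                          ≡⟨ v≡′ ⟩
    outer a + (inner b + m)    <⟨ +-monoʳ-< (outer a) inner-bracket ⟩
    outer a + inner (suc b)    ≤⟨ +-monoʳ-≤ (outer a) (binomT-mono k' r-1 b<) ⟩
    outer a + inner (a ∸ (a div r)) ≤⟨ turan-step r-1 a (a ∸ (a div r)) k-1 ≤-refl ⟩
    outer (suc a) ∎
    where open ≤-Reasoning

  m₀≡ : v ∸ outer a ≡ inner b + m
  m₀≡ = trans (cong (_∸ outer a) v≡′) (m+n∸m≡n (outer a) (inner b + m))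

  run-start : ∀ {n0 ns} → Run k r v n0 ns → n0 ≡ a
  run-start (le , lt , _) = outer-unique le lt outer-≤ outer-<

  tail-p-sum : ∀ {M ns} → Tail k r M ns → M ≡ inner b + m → sum (map (λ n → binomT n p' r-1) ns) ≤ binomT b p' r-1 + d
  tail-p-sum tail-stop _ = z≤n
  tail-p-sum (tail-step {M} {n} {ns} _ le lt t) M≡ =
    ≤-reflexive (cong₂ _+_ (cong (λ z → binomT z p' r-1) n≡b) (tail-d (subst (λ z → Tail k r z ns) M′≡ t) D))
    where
    n≡b : n ≡ b
    n≡b = inner-unique le lt (subst (inner b ≤_) (sym M≡) (m≤m+n (inner b) m)) (subst (_< inner (suc b)) (sym M≡) inner-bracket)
    M′≡ : M ∸ inner n ≡ m
    M′≡ = trans (cong₂ (λ x y → x ∸ inner y) M≡ n≡b) (m+n∸m≡n (inner b) m)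

  faces-p : ∀ {ns Ns} → NbhdsOK a r ns Ns → faces (cone a r Ns) p ≡ binomT a p r + sum (map (λ n → binomT n p' r-1) ns)
  faces-p {ns} {Ns} ok = trans (Cone.cone-faces a r Ns p') (cong (binomT a p r +_) (sum-cliquesIn-nbhds {a} {r} {ns} {Ns} ok p'))

  faces-p-≤ : ∀ {ns Ns} → Tail k r (v ∸ outer a) ns → NbhdsOK a r ns Ns → faces (cone a r Ns) p ≤ w
  faces-p-≤ {ns} {Ns} t ok = begin
    faces (cone a r Ns) p                                   ≡⟨ faces-p ok ⟩
    binomT a p r + sum (map (λ n → binomT n p' r-1) ns)     ≤⟨ +-monoʳ-≤ (binomT a p r) (tail-p-sum t m₀≡) ⟩
    binomT a p r + (binomT b p' r-1 + d)                    ≡⟨ sym (+-assoc (binomT a p r) (binomT b p' r-1) d) ⟩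
    binomT a p r + binomT b p' r-1 + d                      ≤⟨ w≥ ⟩
    w ∎
    where open ≤-Reasoning

  never-fails : (n0 : ℕ) (ns : List ℕ) (Ns : List (Subset n0)) →
    Run k r v n0 ns → NbhdsOK n0 r ns Ns → faces (cone n0 r Ns) p ≤ w
  never-fails n0 ns Ns run = at-a (run-start run) run
    where
    at-a : ∀ {n0} {Ns : List (Subset n0)} → n0 ≡ a → Run k r v n0 ns → NbhdsOK n0 r ns Ns → faces (cone n0 r Ns) p ≤ w
    at-a refl (_ , _ , t) = faces-p-≤ t

  nbhds-small : ∀ {ns Ns} → NbhdsOK a r ns Ns → All (SmallCliquesIn a r-1) Ns
  nbhds-small [] = []
  nbhds-small {n ∷ ns} {N ∷ Ns} (copy ∷ rest) = nbhd-clique-≤ {a} {r} {n} {s'} {N} copy ∷ nbhds-small {ns} {Ns} rest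

  extras-small : ∀ {Es} → ExtrasOK a r p Es → All (SmallCliquesIn a r-1) Es
  extras-small [] = []
  extras-small {E ∷ Es} ((∣E∣ , _) ∷ rest) = small ∷ extras-small {Es} rest
    where
    small : SmallCliquesIn a r-1 E
    small X _ X⊑E = ≤-trans (p⊆q⇒∣p∣≤∣q∣ (⊑⇒⊆ {X = X} {N = E} X⊑E))
                      (≤-trans (≤-reflexive ∣E∣) (≤-trans p≤k' (≤-trans k'≤s' (n≤1+n s'))))

  faces-k-outcome : ∀ {ns} {Ns Es : List (Subset a)} → Tail k r (v ∸ outer a) ns → NbhdsOK a r ns Ns →
    ExtrasOK a r p Es → faces (cone a r (Ns ++ Es)) k ≡ v
  faces-k-outcome {ns} {Ns} {Es} t ok extras = begin
    faces (cone a r (Ns ++ Es)) k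
      ≡⟨ Cone.cone-faces a r (Ns ++ Es) k-1 ⟩
    outer a + sum (map (λ N → cliquesIn a r N k-1) (Ns ++ Es))
      ≡⟨ cong (outer a +_) (sum-map-++ (λ N → cliquesIn a r N k-1) Ns Es) ⟩
    outer a + (sum (map (λ N → cliquesIn a r N k-1) Ns) + sum (map (λ E → cliquesIn a r E k-1) Es))
      ≡⟨ cong (outer a +_) (cong₂ _+_ (sum-cliquesIn-nbhds {a} {r} {ns} {Ns} ok k-1)
                                      (sum-cliquesIn-extras-large {a} {r} {p} {Es} extras k-1 (s≤s p≤k'))) ⟩
    outer a + (sum (map inner ns) + 0)
      ≡⟨ cong (outer a +_) (trans (+-identityʳ _) (tail-sum t)) ⟩
    outer a + (v ∸ outer a)
      ≡⟨ m+[n∸m]≡n outer-≤ ⟩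
    v ∎
    where open ≡-Reasoning

  faces-p-outcome : ∀ {ns} {Ns Es : List (Subset a)} → Tail k r (v ∸ outer a) ns → NbhdsOK a r ns Ns →
    ExtrasOK a r p Es → length Es ≡ w ∸ faces (cone a r Ns) p → faces (cone a r (Ns ++ Es)) p ≡ w
  faces-p-outcome {ns} {Ns} {Es} t ok extras #Es = begin
    faces (cone a r (Ns ++ Es)) p
      ≡⟨ Cone.cone-faces a r (Ns ++ Es) p' ⟩
    binomT a p r + sum (map (λ N → cliquesIn a r N p') (Ns ++ Es))
      ≡⟨ cong (binomT a p r +_) (sum-map-++ (λ N → cliquesIn a r N p') Ns Es) ⟩
    binomT a p r + (sum (map (λ N → cliquesIn a r N p') Ns) + sum (map (λ E → cliquesIn a r E p') Es))
      ≡⟨ cong (binomT a p r +_) (cong₂ _+_ (sum-cliquesIn-nbhds {a} {r} {ns} {Ns} ok p')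
                                           (trans (sum-cliquesIn-extras-exact {a} {r} {p} {Es} extras) #Es)) ⟩
    binomT a p r + (sum (map (λ n → binomT n p' r-1) ns) + (w ∸ faces (cone a r Ns) p))
      ≡⟨ sym (+-assoc (binomT a p r) _ _) ⟩
    (binomT a p r + sum (map (λ n → binomT n p' r-1) ns)) + (w ∸ faces (cone a r Ns) p)
      ≡⟨ cong (_+ (w ∸ faces (cone a r Ns) p)) (sym (faces-p ok)) ⟩
    faces (cone a r Ns) p + (w ∸ faces (cone a r Ns) p)
      ≡⟨ m+[n∸m]≡n (faces-p-≤ t ok) ⟩
    w ∎
    where open ≡-Reasoning

  outcome : (n0 : ℕ) (ns : List ℕ) (Ns Es : List (Subset n0)) →
    Run k r v n0 ns → NbhdsOK n0 r ns Ns → ExtrasOK n0 r p Es →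
    length Es ≡ w ∸ faces (cone n0 r Ns) p →
    dimAtMost (cone n0 r (Ns ++ Es)) r × faces (cone n0 r (Ns ++ Es)) k ≡ v × faces (cone n0 r (Ns ++ Es)) p ≡ w
  outcome n0 ns Ns Es run = at-a (run-start run) run
    where
    at-a : ∀ {n0} {Ns Es : List (Subset n0)} → n0 ≡ a → Run k r v n0 ns → NbhdsOK n0 r ns Ns → ExtrasOK n0 r p Es →
      length Es ≡ w ∸ faces (cone n0 r Ns) p →
      dimAtMost (cone n0 r (Ns ++ Es)) r × faces (cone n0 r (Ns ++ Es)) k ≡ v × faces (cone n0 r (Ns ++ Es)) p ≡ w
    at-a {Ns = Ns} {Es} refl (_ , _ , t) ok extras #Es =
      cone-dim a r-1 (Ns ++ Es) (++⁺ (nbhds-small ok) (extras-small extras)) ,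
      faces-k-outcome t ok extras , faces-p-outcome t ok extras #Es

  -- (ii) the construction can be carried out: the tail b, n_2, n_3, ... (the
  -- indices of d^k_{p,r}(m)) is bounded by a - ⌊a/r⌋, so suitable
  -- neighbourhoods exist, and p-1 ≤ a vertices are available for the extras.

  tail-exists : Σ (List ℕ) λ ns → Tail k r (v ∸ outer a) ns × All (_≤ a ∸ (a div r)) ns
  tail-exists with inner b + m ≟ 0
  ... | yes m₀≡0 = [] , subst (λ z → Tail k r z []) (sym (trans m₀≡ m₀≡0)) tail-stop , []
  ... | no m₀≢0  =
    b ∷ indices D ,
    subst (λ z → Tail k r z (b ∷ indices D)) (sym m₀≡)
      (tail-step (n≢0⇒n>0 m₀≢0) (m≤m+n (inner b) m) inner-bracket
        (subst (λ z → Tail k r z (indices D)) (sym (m+n∸m≡n (inner b) m)) (indices-tail D))) ,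
    <⇒≤ b< ∷ All.map (λ le → ≤-trans le (<⇒≤ b<)) (indices-≤ D b (≤-<-trans (m≤n+m m (inner b)) inner-bracket))

  nbhds-exist : (ns : List ℕ) → All (_≤ a ∸ (a div r)) ns → Σ (List (Subset a)) λ Ns → NbhdsOK a r ns Ns
  nbhds-exist [] [] = [] , []
  nbhds-exist (n ∷ ns) (n≤ ∷ ns≤) with copyInLastNbhd r-1 a n n≤ | nbhds-exist ns ns≤
  ... | N , copy , _ | Ns , ok = N ∷ Ns , copy ∷ ok

  -- p-1 ≤ a: binom(a+1,k)_r > v ≥ 0 forces k ≤ a+1, and p-1 < k-1
  p'≤a : p' ≤ a
  p'≤a with k ≤? suc a
  ... | yes k≤ = ≤-trans p≤k' (≤-pred (≤-pred (≤-trans k≤ (n≤1+n (suc a)))))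
  ... | no k≰  = ⊥-elim (n≮0 (subst (v <_) (binomT-small (suc a) k r (≰⇒> k≰)) outer-<))

  carried-out : Σ ℕ λ n0 → Σ (List ℕ) λ ns → Σ (List (Subset n0)) λ Ns → Σ (List (Subset n0)) λ Es →
    Run k r v n0 ns × NbhdsOK n0 r ns Ns × ExtrasOK n0 r p Es × length Es ≡ w ∸ faces (cone n0 r Ns) p
  carried-out with tail-exists
  ... | ns , t , ns≤ with nbhds-exist ns ns≤
  ... | Ns , ok =
    a , ns , Ns , replicate #extras (initialSegment a p') ,
    (outer-≤ , outer-< , t) , ok ,
    replicate⁺ #extras (∣initialSegment∣ a p' p'≤a ,
                        initialSegment-clique a r-1 p' (≤-trans p≤k' (≤-trans k'≤s' (≤-trans (n≤1+n s') (n≤1+n r-1))))) ,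
    length-replicate #extras
    where
    #extras : ℕ
    #extras = w ∸ faces (cone a r Ns) p

  construction-succeeds : ConstructionSucceeds r k p v w
  construction-succeeds = never-fails , carried-out , outcome

-- Theorem 3.9.  The degenerate parameter ranges contradict p ≥ 1 and
-- p < k ≤ r; otherwise r = s'+2, k = k'+2, p = p'+1 and the construction
-- above applies.
theorem3p9 : (r k p v w : ℕ) → 1 ≤ p → 1 ≤ v → 1 ≤ w → p < k → k ≤ r →
    (a b m : ℕ) →
    v ≡ binomT a k r + binomT b (k ∸ 1) (r ∸ 1) + m →
    b < a ∸ (a div r) →
    m < binomT (b ∸ (b div (r ∸ 1))) (k ∸ 2) (r ∸ 2) →
    (d : ℕ) → DRel p r k m d →
    binomT a p r + binomT b (p ∸ 1) (r ∸ 1) + d ≤ w →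
    ConstructionSucceeds r k p v w
theorem3p9 r k zero v w () _ _ _ _ a b m _ _ _ d _ _
theorem3p9 r zero (suc p') v w _ _ _ () _ a b m _ _ _ d _ _
theorem3p9 r (suc zero) (suc p') v w _ _ _ (s≤s ()) _ a b m _ _ _ d _ _
theorem3p9 zero (suc (suc k')) (suc p') v w _ _ _ _ () a b m _ _ _ d _ _
theorem3p9 (suc zero) (suc (suc k')) (suc p') v w _ _ _ _ (s≤s ()) a b m _ _ _ d _ _
theorem3p9 (suc (suc s')) (suc (suc k')) (suc p') v w _ _ _ (s≤s (s≤s p≤k')) (s≤s (s≤s k'≤s')) a b m v≡ b< m< d D w≥ =
  Construction.construction-succeeds s' k' p' v w a b m d p≤k' k'≤s' v≡ b< m< D w≥
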